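{- Let $d,r\geq 1$. For an alcove $A$ of $r\Delta_{1,d}$, let $\mathrm{word}_1(A)=w_1w_2\cdots w_d$, where $w_i$ is the column index of the unique mark between rows $i$ and $i+1$ of the decorated matrix $\widetilde M_{\mathcal{I}_A}$. Then $\mathrm{word}_1:\mathcal{A}(r\Delta_{1,d})\to[r]^d$ is a bijection.
   Context: $r\Delta_{1,d}=\{x\in\mathbb{R}^{d+1}: x_k\geq 0,\ \sum_k x_k=r\}$; $\mathcal{A}(r\Delta_{1,d})$ is its set of alcoves: the hyperplanes $x_{a+1}+\dots+x_b=m$ ($0\leq a<b\leq d+1$, $m\in\mathbb{Z}$) subdivide it into unimodular simplices, and the alcoves are the maximal ones, identified with their vertex sets $A=\{\vec a_1,\dots,\vec a_{d+1}\}\subset\mathbb{N}^{d+1}$. For $\vec a\in\mathbb{N}^{n}$ with coordinate sum $k$, $I_{\vec a}$ is the $k$-multiset of $[n]$ with $a_t$ copies of $t$. The vertices are ordered so that $I_{\vec a_1},\dots,I_{\vec a_{d+1}}$ is sorted: writing $I_a=\{I_{a1}\leq\dots\leq I_{ar}\}$, $I_{11}\leq I_{21}\leq\dots\leq I_{(d+1)1}\leq I_{12}\leq\dots\leq I_{(d+1)r}$. $\widetilde M_{\mathcal{I}_A}$ is the $(d+1)\times r$ grid with row $a$ equal to $I_a$, where the edge between cells $(a,b)$ and $(a+1,b)$ is marked iff $I_{ab}<I_{(a+1)b}$ (and the bottom edge of $(d+1,b)$ is marked iff $I_{(d+1)b}<I_{1(b+1)}$). It is known that for alcoves of $r\Delta_{1,d}$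 there is exactly one mark between rows $i$ and $i+1$ for each $i$, and no bottom marks. $[r]^d$ is the set of words of length $d$ over $[r]=\{1,\dots,r\}$. -}

module Defs where

open import Data.Nat using (ℕ; zero; suc; _<_; _≤_)
open import Data.Integer as ℤ using (ℤ; +_)
open import Data.Rational as ℚ using (ℚ; floor; 0ℚ)
open import Data.Fin using (Fin; toℕ; inject₁; fromℕ)
open import Data.Vec as Vec using (Vec; lookup)
open import Data.List as List using (List; []; _∷_; _++_; replicate; take; foldr; concat; map; allFin)
open import Data.Nat.ListAction using (sum)
open import Data.Product using (Σ; ∃; _×_)
open import Relation.Binary.PropositionalEquality using (_≡_; _≢_)
open import Relation.Nullary using (¬_)
open import Function.Bundles using (_⇔_)

-- A lattice point of ℕ^{d+1} (coordinates x_1..x_{d+1} stored 0-based).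
Point : ℕ → Set
Point d = Vec ℕ (suc d)

QPoint : ℕ → Set
QPoint d = Vec ℚ (suc d)

sumℚ : List ℚ → ℚ
sumℚ = foldr ℚ._+_ 0ℚ

psumℕ : ∀ {n} → Vec ℕ n → ℕ → ℕ
psumℕ x j = sum (take j (Vec.toList x))

psumℚ : ∀ {n} → Vec ℚ n → ℕ → ℚ
psumℚ x j = sumℚ (take j (Vec.toList x))

-- The linear form  L_{ab}(x) = x_{a+1} + ... + x_b  (as a difference of partial sums)
-- For ℕ we compare  m ≤ L(x)  via  m + psum a ≤ psum b, all in ℤ.
Lℤ : ∀ {n} → Vec ℕ n → ℕ → ℕ → ℤ
Lℤ x a b = + psumℕ x b ℤ.- + psumℕ x a

Lℚ : ∀ {n} → Vec ℚ n → ℕ → ℕ → ℚ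
Lℚ x a b = psumℚ x b ℚ.- psumℚ x a

-- Pairs (a,b) with 0 ≤ a < b ≤ d+1 indexing the hyperplanes x_{a+1}+...+x_b = m,
-- omitting (0,d+1), whose form is constant (= r) on the simplex.
Pair : ℕ → ℕ → ℕ → Set
Pair d a b = (a < b) × (b ≤ suc d) × ¬ ((a ≡ 0) × (b ≡ suc d))

IsInteger : ℚ → Set
IsInteger q = Σ ℤ λ m → q ≡ m ℚ./ 1

GenericInterior : ℕ → (d : ℕ) → QPoint d → Set
GenericInterior r d p =
    (psumℚ p (suc d) ≡ (+ r) ℚ./ 1)
  × (∀ (k : Fin (suc d)) → 0ℚ ℚ.< lookup p k)
  × (∀ a b → Pair d a b → ¬ IsInteger (Lℚ p a b))

-- x is a lattice point of the closed cell (of the subdivision) containing p: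
-- floor(L(p)) ≤ L(x) ≤ floor(L(p)) + 1 for every form L.
InClosedCell : ℕ → (d : ℕ) → QPoint d → Point d → Set
InClosedCell r d p x =
    (psumℕ x (suc d) ≡ r)
  × (∀ a b → Pair d a b →
       (floor (Lℚ p a b) ℤ.≤ Lℤ x a b) × (Lℤ x a b ℤ.≤ floor (Lℚ p a b) ℤ.+ + 1))

-- S (a set of lattice points) is (the vertex set of) an alcove of rΔ_{1,d}:
-- it is the set of lattice points of the closure of a maximal cell, i.e. of the
-- cell containing a generic interior point p.  (Alcoves are unimodular simplices,
-- so their lattice points are exactly their vertices.)
IsAlcove : (r d : ℕ) → (Point d → Set) → Set
IsAlcove r d S = Σ (QPoint d) λ p → GenericInterior r d p × (∀ x → S x ⇔ InClosedCell r d p x)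

-- I_a as the weakly increasing list of its elements (elements t ∈ [n] stored 0-based).
multisetList : ∀ {n} → Vec ℕ n → List ℕ
multisetList {n} a = concat (map (λ t → replicate (lookup a t) (toℕ t)) (allFin n))

nthD : List ℕ → ℕ → ℕ
nthD []       _       = 0
nthD (x ∷ xs) zero    = x
nthD (x ∷ xs) (suc b) = nthD xs b

-- I_{ab}: entry of row a in column b (columns 0-based, b < r).
entry : ∀ {n} → Vec ℕ n → ℕ → ℕ
entry a b = nthD (multisetList a) b

-- Rows of the matrix: an ordering V_0, ..., V_d of the vertices.
Rows : ℕ → Set
Rows d = Fin (suc d) → Point d

Sorted : (r d : ℕ) → Rows d → Set
Sorted r d V =
    (∀ (i : Fin d) b → b < r → entry (V (inject₁ i)) b ≤ entry (V (Fin.suc i)) b)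
  × (∀ b → suc b < r → entry (V (fromℕ d)) b ≤ entry (V Fin.zero) (suc b))
  where import Data.Fin as Fin

Marked : (d : ℕ) → Rows d → Fin d → ℕ → Set
Marked d V i b = entry (V (inject₁ i)) b < entry (V (Fin.suc i)) b
  where import Data.Fin as Fin

SortedEnumeration : (r d : ℕ) → (Point d → Set) → Rows d → Set
SortedEnumeration r d S V =
    (∀ x → S x ⇔ ∃ λ i → V i ≡ x)
  × (∀ i j → V i ≡ V j → i ≡ j)
  × Sorted r d V

IsWord₁ : (r d : ℕ) → (Point d → Set) → Vec (Fin r) d → Set
IsWord₁ r d S w = Σ (Rows d) λ V → SortedEnumeration r d S V ×
  (∀ (i : Fin d) → Marked d V i (toℕ (lookup w i))
                 × (∀ b → b < r → b ≢ toℕ (lookup w i) → ¬ Marked d V i b))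

-- Let p be a generic point of the alcove, y j = p 1 + … + p j its partial sums, and split
-- y j = fN j + φ j into floor and fractional part; φ 1, …, φ d are distinct and nonzero.
-- Since floor (y b - y a) is fN b - fN a, minus 1 when φ b < φ a, a lattice point with partial
-- sums Z lies in the closed alcove iff Z = fN + e for a 0/1-vector e that is monotone in the
-- order of the φ j; so the vertex V i rounds up exactly the y j whose φ j has rank ≥ i.
-- Entry c of row i counts the partial sums of V i that are ≤ c, hence going from row i to row
-- i + 1 only the column fN j of the position j of rank i changes: the word lists the floors
-- fN j in the order of the fractional parts. As j ↦ (fN j, rank of φ j) increases
-- lexicographically, the word determines floors and ranks, hence the alcove. Conversely, a
-- word w is realised by the point whose partial sums are the numbers w i + (i + 1) / (d + 1)
-- in increasing order, followed by r.

module Submission where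

open import Defs
open import Data.Nat using (ℕ; zero; suc; _+_; _∸_; _≤_; _<_; z≤n; s≤s; _≤?_; _<?_)
open import Data.Nat.Properties
open import Data.Nat.ListAction using (sum)
open import Data.Fin as F using (Fin; toℕ; fromℕ<; inject₁; fromℕ)
import Data.Fin.Properties as FP
open import Data.Vec as Vec using (Vec; []; _∷_; lookup; tabulate)
import Data.Vec.Properties as VP
open import Data.List as List using (List; []; _∷_; _++_; replicate; map; concat)
import Data.List.Properties as LP
open import Data.Integer as ℤ using (ℤ; +_; -[1+_]; 0ℤ; 1ℤ; +≤+; +<+; -<-)
import Data.Integer.Properties as ℤP
open import Data.Rational as ℚ using (ℚ; 0ℚ; 1ℚ; mkℚ; floor; ↥_; ↧ₙ_; *≤*; *<*)
open import Data.Nat.Coprimality using (1-coprimeTo) renaming (sym to coprime-sym)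
open import Data.Integer.DivMod using ([n/ℕd]*d≤n; n<s[n/ℕd]*d)
import Data.Rational.Properties as ℚP
open import Data.Rational.Solver using (module +-*-Solver)
import Data.Integer.Solver as ℤ-Solver
open import Data.Product using (Σ; ∃; _×_; _,_; proj₁; proj₂; map₂)
open import Data.Sum as Sum using (_⊎_; inj₁; inj₂)
open import Data.Empty using (⊥; ⊥-elim)
open import Relation.Nullary using (¬_; Dec; yes; no)
open import Relation.Binary using (tri<; tri≈; tri>)
open import Relation.Binary.PropositionalEquality
open import Function using (_∘_; id)
open import Function.Bundles using (_⇔_; mk⇔; Equivalence)

-- Counting on initial segments of ℕ

_⊆[_]_ : (P : ℕ → Set) → ℕ → (Q : ℕ → Set) → Set
P ⊆[ n ] Q = ∀ i → i < n → P i → Q i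

⊆-shift : ∀ {P Q : ℕ → Set} {n} → P ⊆[ suc n ] Q → (P ∘ suc) ⊆[ n ] (Q ∘ suc)
⊆-shift P⊆Q i i<n = P⊆Q (suc i) (s≤s i<n)

count : (n : ℕ) {P : ℕ → Set} → (∀ i → Dec (P i)) → ℕ
count zero    P? = 0
count (suc n) P? with P? 0
... | yes _ = suc (count n (P? ∘ suc))
... | no  _ = count n (P? ∘ suc)

count-mono : ∀ n {P Q : ℕ → Set} (P? : ∀ i → Dec (P i)) (Q? : ∀ i → Dec (Q i)) →
             P ⊆[ n ] Q → count n P? ≤ count n Q?
count-mono zero    P? Q? _   = z≤n
count-mono (suc n) P? Q? P⊆Q with P? 0 | Q? 0
... | yes _ | yes _ = s≤s (count-mono n (P? ∘ suc) (Q? ∘ suc) (⊆-shift P⊆Q))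
... | yes p | no ¬q = ⊥-elim (¬q (P⊆Q 0 (s≤s z≤n) p))
... | no _  | yes _ = m≤n⇒m≤1+n (count-mono n (P? ∘ suc) (Q? ∘ suc) (⊆-shift P⊆Q))
... | no _  | no _  = count-mono n (P? ∘ suc) (Q? ∘ suc) (⊆-shift P⊆Q)

count-mono-< : ∀ n {P Q : ℕ → Set} (P? : ∀ i → Dec (P i)) (Q? : ∀ i → Dec (Q i)) →
               P ⊆[ n ] Q → ∀ j → j < n → ¬ P j → Q j → count n P? < count n Q?
count-mono-< (suc n) P? Q? P⊆Q zero _ ¬pj qj with P? 0 | Q? 0
... | yes p | _     = ⊥-elim (¬pj p)
... | no _  | no ¬q = ⊥-elim (¬q qj)
... | no _  | yes _ = s≤s (count-mono n (P? ∘ suc) (Q? ∘ suc) (⊆-shift P⊆Q))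
count-mono-< (suc n) P? Q? P⊆Q (suc j) (s≤s j<n) ¬pj qj with P? 0 | Q? 0
... | yes _ | yes _ = s≤s (count-mono-< n (P? ∘ suc) (Q? ∘ suc) (⊆-shift P⊆Q) j j<n ¬pj qj)
... | yes p | no ¬q = ⊥-elim (¬q (P⊆Q 0 (s≤s z≤n) p))
... | no _  | yes _ = m<n⇒m<1+n (count-mono-< n (P? ∘ suc) (Q? ∘ suc) (⊆-shift P⊆Q) j j<n ¬pj qj)
... | no _  | no _  = count-mono-< n (P? ∘ suc) (Q? ∘ suc) (⊆-shift P⊆Q) j j<n ¬pj qj

count-cong : ∀ n {P Q : ℕ → Set} (P? : ∀ i → Dec (P i)) (Q? : ∀ i → Dec (Q i)) →
             P ⊆[ n ] Q → Q ⊆[ n ] P → count n P? ≡ count n Q?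
count-cong n P? Q? P⊆Q Q⊆P = ≤-antisym (count-mono n P? Q? P⊆Q) (count-mono n Q? P? Q⊆P)

count-≤ : ∀ n {P : ℕ → Set} (P? : ∀ i → Dec (P i)) → count n P? ≤ n
count-≤ zero    P? = z≤n
count-≤ (suc n) P? with P? 0
... | yes _ = s≤s (count-≤ n (P? ∘ suc))
... | no  _ = m≤n⇒m≤1+n (count-≤ n (P? ∘ suc))

count-< : ∀ n {P : ℕ → Set} (P? : ∀ i → Dec (P i)) → ∀ j → j < n → ¬ P j → count n P? < n
count-< (suc n) P? zero    _         ¬pj with P? 0
... | yes p = ⊥-elim (¬pj p)
... | no  _ = s≤s (count-≤ n (P? ∘ suc))
count-< (suc n) P? (suc j) (s≤s j<n) ¬pj with P? 0
... | yes _ = s≤s (count-< n (P? ∘ suc) j j<n ¬pj)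
... | no  _ = m≤n⇒m≤1+n (count-< n (P? ∘ suc) j j<n ¬pj)

count-zero : ∀ n {P : ℕ → Set} (P? : ∀ i → Dec (P i)) → (∀ i → i < n → ¬ P i) → count n P? ≡ 0
count-zero zero    P? _    = refl
count-zero (suc n) P? none with P? 0
... | yes p = ⊥-elim (none 0 (s≤s z≤n) p)
... | no  _ = count-zero n (P? ∘ suc) (λ i i<n → none (suc i) (s≤s i<n))

𝟙[_≤_] : ℕ → ℕ → ℕ
𝟙[ i ≤ k ] with i ≤? k
... | yes _ = 1
... | no  _ = 0

𝟙-≤1 : ∀ i k → 𝟙[ i ≤ k ] ≤ 1
𝟙-≤1 i k with i ≤? k
... | yes _ = ≤-refl
... | no  _ = z≤n

𝟙-monoʳ : ∀ i {k k′} → k ≤ k′ → 𝟙[ i ≤ k ] ≤ 𝟙[ i ≤ k′ ]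
𝟙-monoʳ i {k} {k′} k≤k′ with i ≤? k | i ≤? k′
... | yes _   | yes _    = ≤-refl
... | yes i≤k | no  i≰k′ = ⊥-elim (i≰k′ (≤-trans i≤k k≤k′))
... | no  _   | _        = z≤n

𝟙-antiˡ : ∀ {i i′} k → i ≤ i′ → 𝟙[ i′ ≤ k ] ≤ 𝟙[ i ≤ k ]
𝟙-antiˡ {i} {i′} k i≤i′ with i ≤? k | i′ ≤? k
... | yes _   | yes _    = ≤-refl
... | no  i≰k | yes i′≤k = ⊥-elim (i≰k (≤-trans i≤i′ i′≤k))
... | _       | no  _    = z≤n

𝟙-yes : ∀ {i k} → i ≤ k → 𝟙[ i ≤ k ] ≡ 1
𝟙-yes {i} {k} i≤k with i ≤? k
... | yes _   = refl
... | no  i≰k = ⊥-elim (i≰k i≤k)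

𝟙-no : ∀ {i k} → k < i → 𝟙[ i ≤ k ] ≡ 0
𝟙-no {i} {k} k<i with i ≤? k
... | yes i≤k = ⊥-elim (<⇒≱ k<i i≤k)
... | no  _   = refl

𝟙-suc : ∀ {i k} → k ≢ i → 𝟙[ suc i ≤ k ] ≡ 𝟙[ i ≤ k ]
𝟙-suc {i} {k} k≢i with suc i ≤? k | i ≤? k
... | yes _     | yes _   = refl
... | yes 1+i≤k | no  i≰k = ⊥-elim (i≰k (≤-trans (n≤1+n i) 1+i≤k))
... | no  1+i≰k | yes i≤k = ⊥-elim (1+i≰k (≤∧≢⇒< i≤k (k≢i ∘ sym)))
... | no  _     | no  _   = refl

monotone01⇒step : ∀ n (s : ℕ → ℕ) → (∀ i → i < n → s i ≤ 1) → (∀ i i′ → i′ < n → i < i′ → s i ≤ s i′) →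
                  ∃ λ k → k ≤ n × (∀ i → i < n → s i ≡ 𝟙[ k ≤ i ])
monotone01⇒step zero    s _    _    = 0 , z≤n , λ _ ()
monotone01⇒step (suc n) s s≤1 mono
  with monotone01⇒step n s (λ i i<n → s≤1 i (m≤n⇒m≤1+n i<n)) (λ i i′ i′<n → mono i i′ (m≤n⇒m≤1+n i′<n))
... | k , k≤n , s≡step with s n in sn≡ | s≤1 n ≤-refl
...   | zero        | _         =
  suc n , ≤-refl , λ i i≤n → trans (n≤0⇒n≡0 (subst (s i ≤_) sn≡ (≤-last i i≤n))) (sym (𝟙-no i≤n))
  where
  ≤-last : ∀ i → i < suc n → s i ≤ s n
  ≤-last i i≤n with m≤n⇒m<n∨m≡n (≤-pred i≤n)
  ... | inj₁ i<n = mono i n ≤-refl i<n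
  ... | inj₂ refl = ≤-refl
...   | suc zero    | _         = k , m≤n⇒m≤1+n k≤n , extend
  where
  extend : ∀ i → i < suc n → s i ≡ 𝟙[ k ≤ i ]
  extend i i≤n with m≤n⇒m<n∨m≡n (≤-pred i≤n)
  ... | inj₁ i<n = s≡step i i<n
  ... | inj₂ refl = trans sn≡ (sym (𝟙-yes k≤n))
...   | suc (suc _) | s≤s ()

-- Partial sums and multisets

lookup-ext : ∀ {A : Set} {n} {xs ys : Vec A n} → (∀ i → lookup xs i ≡ lookup ys i) → xs ≡ ys
lookup-ext {xs = xs} {ys} eq = trans (sym (VP.tabulate∘lookup xs)) (trans (VP.tabulate-cong eq) (VP.tabulate∘lookup ys))

psumℕ-suc : ∀ {n} (x : Vec ℕ n) (t : Fin n) → psumℕ x (suc (toℕ t)) ≡ psumℕ x (toℕ t) + lookup x t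
psumℕ-suc (a ∷ xs) F.zero    = +-comm a 0
psumℕ-suc (a ∷ xs) (F.suc t) = trans (cong (_+_ a) (psumℕ-suc xs t)) (sym (+-assoc a _ _))

psumℚ-suc : ∀ {n} (x : Vec ℚ n) (t : Fin n) → psumℚ x (suc (toℕ t)) ≡ psumℚ x (toℕ t) ℚ.+ lookup x t
psumℚ-suc (a ∷ xs) F.zero    = trans (ℚP.+-identityʳ a) (sym (ℚP.+-identityˡ a))
psumℚ-suc (a ∷ xs) (F.suc t) = trans (cong (a ℚ.+_) (psumℚ-suc xs t)) (sym (ℚP.+-assoc a _ _))

psumℕ-total : ∀ {n} (x : Vec ℕ n) → psumℕ x n ≡ sum (Vec.toList x)
psumℕ-total []       = refl
psumℕ-total (a ∷ xs) = cong (_+_ a) (psumℕ-total xs)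

psumℕ-injective : ∀ {n} (x x′ : Vec ℕ n) → (∀ j → j ≤ n → psumℕ x j ≡ psumℕ x′ j) → x ≡ x′
psumℕ-injective x x′ eq = lookup-ext λ t → +-cancelˡ-≡ (psumℕ x (toℕ t)) _ _ (begin
  psumℕ x (toℕ t) + lookup x t      ≡⟨ psumℕ-suc x t ⟨
  psumℕ x (suc (toℕ t))             ≡⟨ eq (suc (toℕ t)) (FP.toℕ<n t) ⟩
  psumℕ x′ (suc (toℕ t))            ≡⟨ psumℕ-suc x′ t ⟩
  psumℕ x′ (toℕ t) + lookup x′ t    ≡⟨ cong (_+ lookup x′ t) (eq (toℕ t) (<⇒≤ (FP.toℕ<n t))) ⟨
  psumℕ x (toℕ t) + lookup x′ t     ∎)
  where open ≡-Reasoning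

fromPsumsℕ : ∀ n → (ℕ → ℕ) → Vec ℕ n
fromPsumsℕ n Z = tabulate λ t → Z (suc (toℕ t)) ∸ Z (toℕ t)

psumℕ-fromPsumsℕ : ∀ n (Z : ℕ → ℕ) → Z 0 ≡ 0 → (∀ j → j < n → Z j ≤ Z (suc j)) →
                   ∀ j → j ≤ n → psumℕ (fromPsumsℕ n Z) j ≡ Z j
psumℕ-fromPsumsℕ n Z Z0 Z-mono zero    _   = sym Z0
psumℕ-fromPsumsℕ n Z Z0 Z-mono (suc j) j<n = begin
  psumℕ x (suc j)                       ≡⟨ cong (psumℕ x ∘ suc) (FP.toℕ-fromℕ< j<n) ⟨
  psumℕ x (suc (toℕ t))                 ≡⟨ psumℕ-suc x t ⟩
  psumℕ x (toℕ t) + lookup x t          ≡⟨ cong₂ _+_ (cong (psumℕ x) (FP.toℕ-fromℕ< j<n)) (VP.lookup∘tabulate _ t) ⟩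
  psumℕ x j + (Z (suc (toℕ t)) ∸ Z (toℕ t))
    ≡⟨ cong₂ (λ u k → u + (Z (suc k) ∸ Z k)) (psumℕ-fromPsumsℕ n Z Z0 Z-mono j (<⇒≤ j<n)) (FP.toℕ-fromℕ< j<n) ⟩
  Z j + (Z (suc j) ∸ Z j)               ≡⟨ m+[n∸m]≡n (Z-mono j j<n) ⟩
  Z (suc j)                             ∎
  where
  open ≡-Reasoning
  x = fromPsumsℕ n Z
  t = fromℕ< j<n

fromPsumsℚ : ∀ n → (ℕ → ℚ) → Vec ℚ n
fromPsumsℚ n Y = tabulate λ t → Y (suc (toℕ t)) ℚ.- Y (toℕ t)

psumℚ-fromPsumsℚ : ∀ n (Y : ℕ → ℚ) → Y 0 ≡ 0ℚ → ∀ j → j ≤ n → psumℚ (fromPsumsℚ n Y) j ≡ Y j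
psumℚ-fromPsumsℚ n Y Y0 zero    _   = sym Y0
psumℚ-fromPsumsℚ n Y Y0 (suc j) j<n = begin
  psumℚ x (suc j)                        ≡⟨ cong (psumℚ x ∘ suc) (FP.toℕ-fromℕ< j<n) ⟨
  psumℚ x (suc (toℕ t))                  ≡⟨ psumℚ-suc x t ⟩
  psumℚ x (toℕ t) ℚ.+ lookup x t         ≡⟨ cong₂ ℚ._+_ (cong (psumℚ x) (FP.toℕ-fromℕ< j<n)) (VP.lookup∘tabulate _ t) ⟩
  psumℚ x j ℚ.+ (Y (suc (toℕ t)) ℚ.- Y (toℕ t))
    ≡⟨ cong₂ (λ u k → u ℚ.+ (Y (suc k) ℚ.- Y k)) (psumℚ-fromPsumsℚ n Y Y0 j (<⇒≤ j<n)) (FP.toℕ-fromℕ< j<n) ⟩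
  Y j ℚ.+ (Y (suc j) ℚ.- Y j)            ≡⟨ telescope (Y j) (Y (suc j)) ⟩
  Y (suc j)                              ∎
  where
  open ≡-Reasoning
  open +-*-Solver
  x = fromPsumsℚ n Y
  t = fromℕ< j<n
  telescope : ∀ a b → a ℚ.+ (b ℚ.- a) ≡ b
  telescope = solve 2 (λ a b → a :+ (b :- a) := b) refl

psumℚ-nonneg : ∀ {n} (x : Vec ℚ n) → (∀ k → 0ℚ ℚ.≤ lookup x k) → ∀ b → 0ℚ ℚ.≤ psumℚ x b
psumℚ-nonneg []       _   zero    = ℚP.≤-refl
psumℚ-nonneg []       _   (suc b) = ℚP.≤-refl
psumℚ-nonneg (c ∷ xs) _   zero    = ℚP.≤-refl
psumℚ-nonneg (c ∷ xs) x≥0 (suc b) = ℚP.+-mono-≤ (x≥0 F.zero) (psumℚ-nonneg xs (x≥0 ∘ F.suc) b)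

psumℚ-mono : ∀ {n} (x : Vec ℚ n) → (∀ k → 0ℚ ℚ.≤ lookup x k) → ∀ a b → a ≤ b → psumℚ x a ℚ.≤ psumℚ x b
psumℚ-mono x        x≥0 zero    b       _         = psumℚ-nonneg x x≥0 b
psumℚ-mono []       x≥0 (suc a) (suc b) _         = ℚP.≤-refl
psumℚ-mono (c ∷ xs) x≥0 (suc a) (suc b) (s≤s a≤b) = ℚP.+-monoʳ-≤ c (psumℚ-mono xs (x≥0 ∘ F.suc) a b a≤b)

multisetList-∷ : ∀ {n} a (xs : Vec ℕ n) → multisetList (a ∷ xs) ≡ replicate a 0 ++ map suc (multisetList xs)
multisetList-∷ {n} a xs = cong (replicate a 0 ++_) (begin
  concat (map row (List.tabulate F.suc))          ≡⟨ cong concat (LP.map-tabulate F.suc row) ⟩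
  concat (List.tabulate (row ∘ F.suc))
    ≡⟨ cong concat (LP.tabulate-cong λ t → sym (LP.map-replicate suc (lookup xs t) (toℕ t))) ⟩
  concat (List.tabulate (map suc ∘ row′))         ≡⟨ cong concat (LP.map-tabulate row′ (map suc)) ⟨
  concat (map (map suc) (List.tabulate row′))     ≡⟨ LP.concat-map (List.tabulate row′) ⟩
  map suc (concat (List.tabulate row′))           ≡⟨ cong (map suc ∘ concat) (LP.map-tabulate (λ t → t) row′) ⟨
  map suc (multisetList xs)                       ∎)
  where
  open ≡-Reasoning
  row : Fin (suc n) → List ℕ
  row t = replicate (lookup (a ∷ xs) t) (toℕ t)
  row′ : Fin n → List ℕ
  row′ t = replicate (lookup xs t) (toℕ t)

length-multisetList : ∀ {n} (x : Vec ℕ n) → List.length (multisetList x) ≡ sum (Vec.toList x)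
length-multisetList []       = refl
length-multisetList (a ∷ xs) = begin
  List.length (multisetList (a ∷ xs))                          ≡⟨ cong List.length (multisetList-∷ a xs) ⟩
  List.length (replicate a 0 ++ map suc (multisetList xs))     ≡⟨ LP.length-++ (replicate a 0) ⟩
  List.length (replicate a 0) + List.length (map suc (multisetList xs))
    ≡⟨ cong₂ _+_ (LP.length-replicate a) (trans (LP.length-map suc (multisetList xs)) (length-multisetList xs)) ⟩
  a + sum (Vec.toList xs)                                      ∎
  where open ≡-Reasoning

nthD-replicate-++-< : ∀ a v L c → c < a → nthD (replicate a v ++ L) c ≡ v
nthD-replicate-++-< (suc a) v L zero    _         = refl
nthD-replicate-++-< (suc a) v L (suc c) (s≤s c<a) = nthD-replicate-++-< a v L c c<a

nthD-replicate-++-≥ : ∀ a v L c → a ≤ c → nthD (replicate a v ++ L) c ≡ nthD L (c ∸ a)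
nthD-replicate-++-≥ zero    v L c       _         = refl
nthD-replicate-++-≥ (suc a) v L (suc c) (s≤s a≤c) = nthD-replicate-++-≥ a v L c a≤c

nthD-map-suc : ∀ L c → c < List.length L → nthD (map suc L) c ≡ suc (nthD L c)
nthD-map-suc (x ∷ L) zero    _        = refl
nthD-map-suc (x ∷ L) (suc c) (s≤s c<) = nthD-map-suc L c c<

entry≡count : ∀ n (x : Vec ℕ (suc n)) c → c < sum (Vec.toList x) →
              entry x c ≡ count n (λ t → psumℕ x (suc t) ≤? c)
entry≡count n (a ∷ xs) c c<Σ with c <? a
... | yes c<a = begin
  nthD (multisetList (a ∷ xs)) c      ≡⟨ cong (λ L → nthD L c) (multisetList-∷ a xs) ⟩
  nthD (replicate a 0 ++ _) c         ≡⟨ nthD-replicate-++-< a 0 _ c c<a ⟩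
  0                                   ≡⟨ count-zero n _ (λ t _ a+s≤c → <⇒≱ c<a (≤-trans (m≤m+n a _) a+s≤c)) ⟨
  count n (λ t → psumℕ (a ∷ xs) (suc t) ≤? c) ∎
  where open ≡-Reasoning
entry≡count zero (a ∷ []) c c<Σ | no c≮a = ⊥-elim (c≮a (subst (c <_) (+-identityʳ a) c<Σ))
entry≡count (suc n) (a ∷ xs) c c<Σ | no c≮a = begin
  nthD (multisetList (a ∷ xs)) c                   ≡⟨ cong (λ L → nthD L c) (multisetList-∷ a xs) ⟩
  nthD (replicate a 0 ++ map suc (multisetList xs)) c ≡⟨ nthD-replicate-++-≥ a 0 _ c a≤c ⟩
  nthD (map suc (multisetList xs)) (c ∸ a)
    ≡⟨ nthD-map-suc (multisetList xs) (c ∸ a) (subst (c ∸ a <_) (sym (length-multisetList xs)) c∸a<Σ) ⟩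
  suc (entry xs (c ∸ a))                           ≡⟨ cong suc (entry≡count n xs (c ∸ a) c∸a<Σ) ⟩
  suc (count n (λ t → psumℕ xs (suc t) ≤? c ∸ a))  ≡⟨ cong suc (count-cong n _ _ shift⇒ shift⇐) ⟩
  suc (count n (λ t → psumℕ (a ∷ xs) (suc (suc t)) ≤? c)) ≡⟨ count-suc ⟨
  count (suc n) (λ t → psumℕ (a ∷ xs) (suc t) ≤? c)   ∎
  where
  open ≡-Reasoning
  a≤c : a ≤ c
  a≤c = ≮⇒≥ c≮a
  a+[c∸a]≡c : a + (c ∸ a) ≡ c
  a+[c∸a]≡c = m+[n∸m]≡n a≤c
  c∸a<Σ : c ∸ a < sum (Vec.toList xs)
  c∸a<Σ = +-cancelˡ-< a _ _ (subst (_< a + sum (Vec.toList xs)) (sym a+[c∸a]≡c) c<Σ)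
  shift⇒ : (λ t → psumℕ xs (suc t) ≤ c ∸ a) ⊆[ n ] (λ t → a + psumℕ xs (suc t) ≤ c)
  shift⇒ t _ s≤ = subst (a + psumℕ xs (suc t) ≤_) a+[c∸a]≡c (+-monoʳ-≤ a s≤)
  shift⇐ : (λ t → a + psumℕ xs (suc t) ≤ c) ⊆[ n ] (λ t → psumℕ xs (suc t) ≤ c ∸ a)
  shift⇐ t _ a+s≤ = +-cancelˡ-≤ a _ _ (subst (a + psumℕ xs (suc t) ≤_) (sym a+[c∸a]≡c) a+s≤)
  count-suc : count (suc n) (λ t → psumℕ (a ∷ xs) (suc t) ≤? c) ≡ suc (count n (λ t → psumℕ (a ∷ xs) (suc (suc t)) ≤? c))
  count-suc with psumℕ (a ∷ xs) 1 ≤? c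
  ... | yes _  = refl
  ... | no a≰c = ⊥-elim (a≰c (subst (_≤ c) (sym (+-identityʳ a)) a≤c))

-- Rankings of {0, …, n-1}

record InverseOn (n : ℕ) (g h : ℕ → ℕ) : Set where
  field
    g-< : ∀ a → a < n → g a < n
    h-< : ∀ i → i < n → h i < n
    h∘g : ∀ a → a < n → h (g a) ≡ a
    g∘h : ∀ i → i < n → g (h i) ≡ i

InverseOn-sym : ∀ {n g h} → InverseOn n g h → InverseOn n h g
InverseOn-sym inv = record { g-< = h-< ; h-< = g-< ; h∘g = g∘h ; g∘h = h∘g }
  where open InverseOn inv

record StrictTotalOn (n : ℕ) (R : ℕ → ℕ → Set) : Set where
  field
    asym      : ∀ a b → R a b → ¬ R b a
    connected : ∀ a b → a < n → b < n → a ≢ b → R a b ⊎ R b a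

Ranks : ℕ → (ℕ → ℕ → Set) → (ℕ → ℕ) → Set
Ranks n R g = ∀ a b → a < n → b < n → R a b → g a < g b

Lists : ℕ → (ℕ → ℕ → Set) → (ℕ → ℕ) → Set
Lists n R h = ∀ i j → j < n → i < j → R (h i) (h j)

strictMono⇒id : ∀ n (g : ℕ → ℕ) → (∀ a → a < n → g a < n) → (∀ a → suc a < n → g a < g (suc a)) →
                ∀ a → a < n → g a ≡ a
strictMono⇒id n g g-< g-mono a a<n = ≤-antisym (atMost (n ∸ suc a) a (m+[n∸m]≡n a<n)) (atLeast a a<n)
  where
  atLeast : ∀ a → a < n → a ≤ g a
  atLeast zero    _     = z≤n
  atLeast (suc a) 1+a<n = ≤-<-trans (atLeast a (<⇒≤ 1+a<n)) (g-mono a 1+a<n)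
  atMost : ∀ k a → suc a + k ≡ n → g a ≤ a
  atMost zero    a 1+a≡n = ≤-pred (subst (g a <_) (trans (sym 1+a≡n) (+-identityʳ (suc a)))
                                            (g-< a (subst (a <_) (trans (sym (+-identityʳ (suc a))) 1+a≡n) ≤-refl)))
  atMost (suc k) a 1+a+k≡n = ≤-pred (<-≤-trans (g-mono a 2+a≤n) (atMost k (suc a) (trans (sym (+-suc (suc a) k)) 1+a+k≡n)))
    where
    2+a≤n : suc a < n
    2+a≤n = subst (suc a <_) 1+a+k≡n (s≤s (subst (a <_) (sym (+-suc a k)) (s≤s (m≤m+n a k))))

strictMono⇒id-Fin : ∀ {m} (g : Fin (suc m) → Fin (suc m)) → (∀ (a : Fin m) → toℕ (g (inject₁ a)) < toℕ (g (F.suc a))) →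
                    ∀ a → g a ≡ a
strictMono⇒id-Fin {m} g g-mono a =
  FP.toℕ-injective (trans (sym (gℕ-toℕ a)) (strictMono⇒id (suc m) gℕ gℕ-< gℕ-mono (toℕ a) (FP.toℕ<n a)))
  where
  gℕ : ℕ → ℕ
  gℕ n with n <? suc m
  ... | yes n<1+m = toℕ (g (fromℕ< n<1+m))
  ... | no  _     = 0
  gℕ-fromℕ< : ∀ n (n<1+m : n < suc m) → gℕ n ≡ toℕ (g (fromℕ< n<1+m))
  gℕ-fromℕ< n n<1+m with n <? suc m
  ... | yes n<1+m′ = cong (λ lt → toℕ (g (fromℕ< lt))) (≤-irrelevant n<1+m′ n<1+m)
  ... | no  n≮1+m  = ⊥-elim (n≮1+m n<1+m)
  gℕ-toℕ : ∀ a → gℕ (toℕ a) ≡ toℕ (g a)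
  gℕ-toℕ a = trans (gℕ-fromℕ< (toℕ a) (FP.toℕ<n a)) (cong (toℕ ∘ g) (FP.fromℕ<-toℕ a (FP.toℕ<n a)))
  gℕ-< : ∀ n → n < suc m → gℕ n < suc m
  gℕ-< n n<1+m = subst (_< suc m) (sym (gℕ-fromℕ< n n<1+m)) (FP.toℕ<n _)
  gℕ-mono : ∀ n → suc n < suc m → gℕ n < gℕ (suc n)
  gℕ-mono n 1+n<1+m = subst₂ _<_ (gℕ-at (trans (FP.toℕ-inject₁ a′) (FP.toℕ-fromℕ< n<m)))
                                   (gℕ-at (cong suc (FP.toℕ-fromℕ< n<m))) (g-mono a′)
    where
    n<m = ≤-pred 1+n<1+m
    a′ = fromℕ< n<m
    gℕ-at : ∀ {b k} → toℕ b ≡ k → toℕ (g b) ≡ gℕ k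
    gℕ-at {b} refl = sym (gℕ-toℕ b)

module _ {n : ℕ} {R : ℕ → ℕ → Set} {g h : ℕ → ℕ} (inv : InverseOn n g h) where
  open InverseOn inv

  ranks⇒lists : StrictTotalOn n R → Ranks n R g → Lists n R h
  ranks⇒lists R-total g-ranks i j j<n i<j
    with StrictTotalOn.connected R-total (h i) (h j) (h-< i i<n) (h-< j j<n) hi≢hj
    where
    i<n = <-trans i<j j<n
    hi≢hj : h i ≢ h j
    hi≢hj hi≡hj = <-irrefl (trans (sym (g∘h i i<n)) (trans (cong g hi≡hj) (g∘h j j<n))) i<j
  ... | inj₁ R[hi,hj] = R[hi,hj]
  ... | inj₂ R[hj,hi] = ⊥-elim (<-asym i<j (subst₂ _<_ (g∘h j j<n) (g∘h i (<-trans i<j j<n))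
                                  (g-ranks (h j) (h i) (h-< j j<n) (h-< i (<-trans i<j j<n)) R[hj,hi])))

  lists⇒ranks : (∀ a b → R a b → ¬ R b a) → Lists n R g → Ranks n R h
  lists⇒ranks R-asym g-lists i j i<n j<n R[i,j] with <-cmp (h i) (h j)
  ... | tri< hi<hj _ _ = hi<hj
  ... | tri≈ _ hi≡hj _ = ⊥-elim (R-asym i i R[i,i] R[i,i])
    where
    R[i,i] = subst (R i) (trans (sym (g∘h j j<n)) (trans (cong g (sym hi≡hj)) (g∘h i i<n))) R[i,j]
  ... | tri> _ _ hj<hi = ⊥-elim (R-asym i j R[i,j] (subst₂ R (g∘h j j<n) (g∘h i i<n) (g-lists (h j) (h i) (h-< i i<n) hj<hi)))

ranking-unique : ∀ {n R g h h′} → (∀ a → a < n → g a < n) → InverseOn n h h′ → StrictTotalOn n R →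
                 Ranks n R g → Ranks n R h → ∀ a → a < n → g a ≡ h a
ranking-unique {n} {R} {g} {h} {h′} g-bounded inv R-total g-ranks h-ranks a a<n = begin
  g a            ≡⟨ cong g (h∘g a a<n) ⟨
  g (h′ (h a))   ≡⟨ strictMono⇒id n (g ∘ h′) (λ i i<n → g-bounded (h′ i) (h-< i i<n)) g∘h′-mono (h a) (g-< a a<n) ⟩
  h a            ∎
  where
  open ≡-Reasoning
  open InverseOn inv using (g-<; h-<; h∘g)
  h′-lists : Lists n R h′
  h′-lists = ranks⇒lists inv R-total h-ranks
  g∘h′-mono : ∀ i → suc i < n → g (h′ i) < g (h′ (suc i))
  g∘h′-mono i 1+i<n = g-ranks (h′ i) (h′ (suc i)) (h-< i (<-trans (n<1+n i) 1+i<n)) (h-< (suc i) 1+i<n)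
                               (h′-lists i (suc i) 1+i<n (n<1+n i))

injective⇒surjective : ∀ {n} (f : Fin n → Fin n) → (∀ a b → f a ≡ f b → a ≡ b) → ∀ v → ∃ λ a → f a ≡ v
injective⇒surjective {suc m} f f-inj v with FP.any? (λ a → f a FP.≟ v)
... | yes hit  = hit
... | no ¬hit = ⊥-elim (<-irrefl refl (FP.injective⇒≤ {f = f′} f′-inj))
  where
  v∉f : ∀ a → v ≢ f a
  v∉f a v≡fa = ¬hit (a , sym v≡fa)
  f′ : Fin (suc m) → Fin m
  f′ a = F.punchOut (v∉f a)
  f′-inj : ∀ {a b} → f′ a ≡ f′ b → a ≡ b
  f′-inj {a} {b} eq = f-inj a b (FP.punchOut-injective (v∉f a) (v∉f b) eq)

module Ranking (n : ℕ) (key : ℕ → ℚ) (key-injective : ∀ a b → a < n → b < n → a ≢ b → key a ≢ key b) where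

  KeyOrder : ℕ → ℕ → Set
  KeyOrder a b = key a ℚ.< key b

  keyOrder-strictTotal : StrictTotalOn n KeyOrder
  keyOrder-strictTotal = record { asym = λ a b → ℚP.<-asym ; connected = connected }
    where
    connected : ∀ a b → a < n → b < n → a ≢ b → KeyOrder a b ⊎ KeyOrder b a
    connected a b a<n b<n a≢b with ℚP.<-cmp (key a) (key b)
    ... | tri< ka<kb _ _ = inj₁ ka<kb
    ... | tri≈ _ ka≡kb _ = ⊥-elim (key-injective a b a<n b<n a≢b ka≡kb)
    ... | tri> _ _ kb<ka = inj₂ kb<ka

  rank : ℕ → ℕ
  rank a = count n (λ b → key b ℚP.<? key a)

  rank-< : ∀ a → a < n → rank a < n
  rank-< a a<n = count-< n _ a a<n (ℚP.<-irrefl refl)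

  rank-ranks : Ranks n KeyOrder rank
  rank-ranks a b a<n b<n ka<kb = count-mono-< n _ _ (λ _ _ kc<ka → ℚP.<-trans kc<ka ka<kb) a a<n (ℚP.<-irrefl refl) ka<kb

  rank-injective : ∀ a b → a < n → b < n → rank a ≡ rank b → a ≡ b
  rank-injective a b a<n b<n ra≡rb with a ≟ b
  ... | yes a≡b = a≡b
  ... | no a≢b with StrictTotalOn.connected keyOrder-strictTotal a b a<n b<n a≢b
  ...   | inj₁ ka<kb = ⊥-elim (<-irrefl ra≡rb (rank-ranks a b a<n b<n ka<kb))
  ...   | inj₂ kb<ka = ⊥-elim (<-irrefl (sym ra≡rb) (rank-ranks b a b<n a<n kb<ka))

  private
    rankFin : Fin n → Fin n
    rankFin a = fromℕ< (rank-< (toℕ a) (FP.toℕ<n a))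

    rankFin-injective : ∀ a b → rankFin a ≡ rankFin b → a ≡ b
    rankFin-injective a b eq = FP.toℕ-injective (rank-injective (toℕ a) (toℕ b) (FP.toℕ<n a) (FP.toℕ<n b)
      (trans (sym (FP.toℕ-fromℕ< _)) (trans (cong toℕ eq) (FP.toℕ-fromℕ< _))))

    preimage : ∀ i → i < n → ∃ λ a → a < n × rank a ≡ i
    preimage i i<n with injective⇒surjective rankFin rankFin-injective (fromℕ< i<n)
    ... | a , eq = toℕ a , FP.toℕ<n a , trans (sym (FP.toℕ-fromℕ< _)) (trans (cong toℕ eq) (FP.toℕ-fromℕ< i<n))

  opaque
    unrank : ℕ → ℕ
    unrank i with i <? n
    ... | yes i<n = proj₁ (preimage i i<n)
    ... | no  _   = 0

    unrank-spec : ∀ i → i < n → unrank i < n × rank (unrank i) ≡ i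
    unrank-spec i i<n with i <? n
    ... | yes i<n′ = proj₂ (preimage i i<n′)
    ... | no  i≮n  = ⊥-elim (i≮n i<n)

  inverse : InverseOn n rank unrank
  inverse = record
    { g-< = rank-<
    ; h-< = λ i i<n → proj₁ (unrank-spec i i<n)
    ; h∘g = λ a a<n → rank-injective _ a (proj₁ (unrank-spec (rank a) (rank-< a a<n))) a<n
                                            (proj₂ (unrank-spec (rank a) (rank-< a a<n)))
    ; g∘h = λ i i<n → proj₂ (unrank-spec i i<n)
    }

LexIncreasing : ℕ → (ℕ → ℕ) → (ℕ → ℕ) → Set
LexIncreasing n f ρ = ∀ t t′ → t < t′ → t′ < n → f t < f t′ ⊎ (f t ≡ f t′ × ρ t < ρ t′)

module LexOrder (n : ℕ) (W : ℕ → ℕ) where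

  LexBefore : ℕ → ℕ → Set
  LexBefore i j = W i < W j ⊎ (W i ≡ W j × i < j)

  lexBefore-asym : ∀ i j → LexBefore i j → ¬ LexBefore j i
  lexBefore-asym i j (inj₁ Wi<Wj)       (inj₁ Wj<Wi)       = <-asym Wi<Wj Wj<Wi
  lexBefore-asym i j (inj₁ Wi<Wj)       (inj₂ (Wj≡Wi , _)) = <-irrefl (sym Wj≡Wi) Wi<Wj
  lexBefore-asym i j (inj₂ (Wi≡Wj , _)) (inj₁ Wj<Wi)       = <-irrefl (sym Wi≡Wj) Wj<Wi
  lexBefore-asym i j (inj₂ (_ , i<j))   (inj₂ (_ , j<i))   = <-asym i<j j<i

  lexBefore-strictTotal : StrictTotalOn n LexBefore
  lexBefore-strictTotal = record { asym = lexBefore-asym ; connected = connected }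
    where
    connected : ∀ i j → i < n → j < n → i ≢ j → LexBefore i j ⊎ LexBefore j i
    connected i j _ _ i≢j with <-cmp (W i) (W j) | <-cmp i j
    ... | tri< Wi<Wj _ _ | _              = inj₁ (inj₁ Wi<Wj)
    ... | tri> _ _ Wj<Wi | _              = inj₂ (inj₁ Wj<Wi)
    ... | tri≈ _ Wi≡Wj _ | tri< i<j _ _   = inj₁ (inj₂ (Wi≡Wj , i<j))
    ... | tri≈ _ _ _     | tri≈ _ i≡j _   = ⊥-elim (i≢j i≡j)
    ... | tri≈ _ Wi≡Wj _ | tri> _ _ j<i   = inj₂ (inj₂ (sym Wi≡Wj , j<i))

  unrank-ranks-lex : ∀ {f ρ π} → InverseOn n ρ π → (∀ i → i < n → f (π i) ≡ W i) → LexIncreasing n f ρ →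
                     Ranks n LexBefore π
  unrank-ranks-lex {f} {ρ} {π} inv f∘π≡W lex = lists⇒ranks inv lexBefore-asym ρ-lists
    where
    open InverseOn inv
    f≡W∘ρ : ∀ t → t < n → f t ≡ W (ρ t)
    f≡W∘ρ t t<n = trans (cong f (sym (h∘g t t<n))) (f∘π≡W (ρ t) (g-< t t<n))
    ρ-lists : Lists n LexBefore ρ
    ρ-lists t t′ t′<n t<t′ with lex t t′ t<t′ t′<n
    ... | inj₁ ft<ft′          = inj₁ (subst₂ _<_ (f≡W∘ρ t (<-trans t<t′ t′<n)) (f≡W∘ρ t′ t′<n) ft<ft′)
    ... | inj₂ (ft≡ft′ , ρt<ρt′) =
      inj₂ (trans (sym (f≡W∘ρ t (<-trans t<t′ t′<n))) (trans ft≡ft′ (f≡W∘ρ t′ t′<n)) , ρt<ρt′)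

  lex-unique : ∀ {f ρ π f′ ρ′ π′} → InverseOn n ρ π → InverseOn n ρ′ π′ →
               (∀ i → i < n → f (π i) ≡ W i) → (∀ i → i < n → f′ (π′ i) ≡ W i) →
               LexIncreasing n f ρ → LexIncreasing n f′ ρ′ →
               ∀ t → t < n → ρ t ≡ ρ′ t × f t ≡ f′ t
  lex-unique {f} {ρ} {π} {f′} {ρ′} {π′} inv inv′ f∘π≡W f′∘π′≡W lex lex′ t t<n = ρt≡ρ′t , ft≡f′t
    where
    open InverseOn
    π≡π′ : ∀ i → i < n → π i ≡ π′ i
    π≡π′ = ranking-unique (h-< inv) (InverseOn-sym inv′) lexBefore-strictTotal
             (unrank-ranks-lex inv f∘π≡W lex) (unrank-ranks-lex inv′ f′∘π′≡W lex′)
    ρt≡ρ′t : ρ t ≡ ρ′ t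
    ρt≡ρ′t = begin
      ρ t              ≡⟨ cong ρ (h∘g inv′ t t<n) ⟨
      ρ (π′ (ρ′ t))    ≡⟨ cong ρ (π≡π′ (ρ′ t) (g-< inv′ t t<n)) ⟨
      ρ (π (ρ′ t))     ≡⟨ g∘h inv (ρ′ t) (g-< inv′ t t<n) ⟩
      ρ′ t             ∎
      where open ≡-Reasoning
    ft≡f′t : f t ≡ f′ t
    ft≡f′t = begin
      f t              ≡⟨ cong f (h∘g inv t t<n) ⟨
      f (π (ρ t))      ≡⟨ f∘π≡W (ρ t) (g-< inv t t<n) ⟩
      W (ρ t)          ≡⟨ cong W ρt≡ρ′t ⟩
      W (ρ′ t)         ≡⟨ f′∘π′≡W (ρ′ t) (g-< inv′ t t<n) ⟨
      f′ (π′ (ρ′ t))   ≡⟨ cong f′ (h∘g inv′ t t<n) ⟩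
      f′ t             ∎
      where open ≡-Reasoning

-- Integer and rational arithmetic

+-cancelˡ-≤ℤ : ∀ c {i j} → c ℤ.+ i ℤ.≤ c ℤ.+ j → i ℤ.≤ j
+-cancelˡ-≤ℤ c {i} {j} c+i≤c+j = subst₂ ℤ._≤_ (cancel i) (cancel j) (ℤP.+-monoʳ-≤ (ℤ.- c) c+i≤c+j)
  where
  open ℤ-Solver.+-*-Solver
  cancel : ∀ x → ℤ.- c ℤ.+ (c ℤ.+ x) ≡ x
  cancel = solve 2 (λ c x → (:- c) :+ (c :+ x) := x) refl c

module ExcessDifference (A B ea eb : ℕ) where
  open ℤ-Solver.+-*-Solver

  c : ℤ
  c = + B ℤ.- + A

  c≡c+0 : c ≡ c ℤ.+ 0ℤ
  c≡c+0 = sym (ℤP.+-identityʳ c)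

  [c-1]+1≡c+0 : (c ℤ.- 1ℤ) ℤ.+ 1ℤ ≡ c ℤ.+ 0ℤ
  [c-1]+1≡c+0 = solve 1 (λ c → (c :- con 1ℤ) :+ con 1ℤ := c :+ con 0ℤ) refl c

  diff≡c+t : + (B + eb) ℤ.- + (A + ea) ≡ c ℤ.+ (+ eb ℤ.- + ea)
  diff≡c+t rewrite ℤP.pos-+ B eb | ℤP.pos-+ A ea =
    solve 4 (λ A B ea eb → (B :+ eb) :- (A :+ ea) := (B :- A) :+ (eb :- ea)) refl (+ A) (+ B) (+ ea) (+ eb)

  ≤diff⇒≤ : c ℤ.≤ + (B + eb) ℤ.- + (A + ea) → ea ≤ eb
  ≤diff⇒≤ c≤diff = ℤP.drop‿+≤+ (ℤP.0≤i-j⇒j≤i (+-cancelˡ-≤ℤ c (subst₂ ℤ._≤_ c≡c+0 diff≡c+t c≤diff)))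

  diff≤⇒≥ : + (B + eb) ℤ.- + (A + ea) ℤ.≤ (c ℤ.- 1ℤ) ℤ.+ 1ℤ → eb ≤ ea
  diff≤⇒≥ diff≤c = ℤP.drop‿+≤+ (ℤP.i-j≤0⇒i≤j (+-cancelˡ-≤ℤ c (subst₂ ℤ._≤_ diff≡c+t [c-1]+1≡c+0 diff≤c)))

  ≤⇒diff-between : ea ≤ eb → eb ≤ 1 → c ℤ.≤ + (B + eb) ℤ.- + (A + ea) × + (B + eb) ℤ.- + (A + ea) ℤ.≤ c ℤ.+ 1ℤ
  ≤⇒diff-between ea≤eb eb≤1 rewrite diff≡c+t =
      subst (ℤ._≤ c ℤ.+ _) (sym c≡c+0) (ℤP.+-monoʳ-≤ c (ℤP.i≤j⇒0≤j-i (+≤+ ea≤eb)))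
    , ℤP.+-monoʳ-≤ c (ℤP.≤-trans (ℤP.i-j≤i (+ eb) (+ ea)) (+≤+ eb≤1))

  ≥⇒diff-between : eb ≤ ea → ea ≤ 1 →
                   c ℤ.- 1ℤ ℤ.≤ + (B + eb) ℤ.- + (A + ea) × + (B + eb) ℤ.- + (A + ea) ℤ.≤ (c ℤ.- 1ℤ) ℤ.+ 1ℤ
  ≥⇒diff-between eb≤ea ea≤1 rewrite diff≡c+t =
      ℤP.+-monoʳ-≤ c (ℤP.≤-trans (ℤP.neg-mono-≤ (+≤+ ea≤1)) (ℤP.i≤j+i (ℤ.- + ea) (+ eb)))
    , subst (c ℤ.+ _ ℤ.≤_) (sym [c-1]+1≡c+0) (ℤP.+-monoʳ-≤ c (ℤP.i≤j⇒i-j≤0 (+≤+ eb≤ea)))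

0≤+n-+m⇒m≤n : ∀ {m n} → 0ℤ ℤ.≤ + n ℤ.- + m → m ≤ n
0≤+n-+m⇒m≤n 0≤n-m = ℤP.drop‿+≤+ (ℤP.0≤i-j⇒j≤i 0≤n-m)

0≤+n-+m-1⇒m<n : ∀ {m n} → 0ℤ ℤ.≤ (+ n ℤ.- + m) ℤ.- 1ℤ → m < n
0≤+n-+m-1⇒m<n {m} {n} 0≤n-m-1 = 0≤+n-+m⇒m≤n (subst (0ℤ ℤ.≤_) n-m-1≡n-[1+m] 0≤n-m-1)
  where
  open ℤ-Solver.+-*-Solver
  n-m-1≡n-[1+m] : (+ n ℤ.- + m) ℤ.- 1ℤ ≡ + n ℤ.- + suc m
  n-m-1≡n-[1+m] = trans (solve 2 (λ n m → (n :- m) :- con 1ℤ := n :- (con 1ℤ :+ m)) refl (+ n) (+ m))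
                        (cong (λ z → + n ℤ.- z) (sym (ℤP.pos-+ 1 m)))

ι : ℤ → ℚ
ι m = m ℚ./ 1

ι≡mkℚ : ∀ m → ι m ≡ mkℚ m 0 (coprime-sym (1-coprimeTo ℤ.∣ m ∣))
ι≡mkℚ m = ℚP.↥p/↧p≡p (mkℚ m 0 _)

ι-mono-≤ : ∀ {m k} → m ℤ.≤ k → ι m ℚ.≤ ι k
ι-mono-≤ {m} {k} m≤k rewrite ι≡mkℚ m | ι≡mkℚ k =
  *≤* (subst₂ ℤ._≤_ (sym (ℤP.*-identityʳ m)) (sym (ℤP.*-identityʳ k)) m≤k)

ι-mono-< : ∀ {m k} → m ℤ.< k → ι m ℚ.< ι k
ι-mono-< {m} {k} m<k rewrite ι≡mkℚ m | ι≡mkℚ k =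
  *<* (subst₂ ℤ._<_ (sym (ℤP.*-identityʳ m)) (sym (ℤP.*-identityʳ k)) m<k)

ι-cancel-< : ∀ {m k} → ι m ℚ.< ι k → m ℤ.< k
ι-cancel-< {m} {k} ιm<ιk rewrite ι≡mkℚ m | ι≡mkℚ k with ιm<ιk
... | *<* m*1<k*1 = subst₂ ℤ._<_ (ℤP.*-identityʳ m) (ℤP.*-identityʳ k) m*1<k*1

ι-+ : ∀ m k → ι (m ℤ.+ k) ≡ ι m ℚ.+ ι k
ι-+ m k rewrite ι≡mkℚ m | ι≡mkℚ k = cong ι (cong₂ ℤ._+_ (sym (ℤP.*-identityʳ m)) (sym (ℤP.*-identityʳ k)))

ι-− : ∀ m k → ι (m ℤ.- k) ≡ ι m ℚ.- ι k
ι-− m k = begin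
  ι (m ℤ.- k)                          ≡⟨ ι-+ m (ℤ.- k) ⟩
  ι m ℚ.+ ι (ℤ.- k)                    ≡⟨ cong (ι m ℚ.+_) (solve 2 (λ x y → x := (x :+ y) :- y) refl (ι (ℤ.- k)) (ι k)) ⟩
  ι m ℚ.+ (ι (ℤ.- k) ℚ.+ ι k ℚ.- ι k)   ≡⟨ cong (λ z → ι m ℚ.+ (z ℚ.- ι k)) (sym (ι-+ (ℤ.- k) k)) ⟩
  ι m ℚ.+ (ι (ℤ.- k ℤ.+ k) ℚ.- ι k)     ≡⟨ cong (λ z → ι m ℚ.+ (ι z ℚ.- ι k)) (ℤP.+-inverseˡ k) ⟩
  ι m ℚ.+ (0ℚ ℚ.- ι k)                 ≡⟨ cong (ι m ℚ.+_) (ℚP.+-identityˡ (ℚ.- ι k)) ⟩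
  ι m ℚ.- ι k                          ∎
  where
  open ≡-Reasoning
  open +-*-Solver

floor≡↥/↧ : ∀ q → floor q ≡ (↥ q) ℤ./ℕ (↧ₙ q)
floor≡↥/↧ (mkℚ _ _ _) = ℤP.*-identityˡ _

floor-≤ : ∀ q → ι (floor q) ℚ.≤ q
floor-≤ q@(mkℚ n d _) rewrite ι≡mkℚ (floor q) =
  *≤* (subst₂ ℤ._≤_ (cong (ℤ._* + suc d) (sym (floor≡↥/↧ q))) (sym (ℤP.*-identityʳ n)) ([n/ℕd]*d≤n n (suc d)))

<-floor+1 : ∀ q → q ℚ.< ι (floor q ℤ.+ 1ℤ)
<-floor+1 q@(mkℚ n d _) rewrite ι≡mkℚ (floor q ℤ.+ 1ℤ) =
  *<* (subst₂ ℤ._<_ (sym (ℤP.*-identityʳ n))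
                    (cong (ℤ._* + suc d) (trans (cong ℤ.suc (sym (floor≡↥/↧ q))) (ℤP.+-comm 1ℤ (floor q))))
                    (n<s[n/ℕd]*d n (suc d)))

<+1⇒≤ : ∀ {m k} → m ℤ.< k ℤ.+ 1ℤ → m ℤ.≤ k
<+1⇒≤ {m} {k} m<k+1 = subst (m ℤ.≤_) (trans (cong ℤ.pred (ℤP.+-comm k 1ℤ)) (ℤP.pred-suc k)) (ℤP.i<j⇒i≤pred[j] m<k+1)

floor-unique : ∀ q m → ι m ℚ.≤ q → q ℚ.< ι (m ℤ.+ 1ℤ) → floor q ≡ m
floor-unique q m ιm≤q q<ιm+1 = ℤP.≤-antisym
  (<+1⇒≤ (ι-cancel-< (ℚP.≤-<-trans (floor-≤ q) q<ιm+1)))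
  (<+1⇒≤ (ι-cancel-< (ℚP.≤-<-trans ιm≤q (<-floor+1 q))))

floor-nonneg : ∀ q → 0ℚ ℚ.≤ q → 0ℤ ℤ.≤ floor q
floor-nonneg q 0≤q = <+1⇒≤ (ι-cancel-< (ℚP.≤-<-trans 0≤q (<-floor+1 q)))

InUnit : ℚ → Set
InUnit α = 0ℚ ℚ.≤ α × α ℚ.< 1ℚ

floor-ι+ : ∀ m {δ} → InUnit δ → floor (ι m ℚ.+ δ) ≡ m
floor-ι+ m {δ} (0≤δ , δ<1) = floor-unique _ m
  (subst (ℚ._≤ ι m ℚ.+ δ) (ℚP.+-identityʳ (ι m)) (ℚP.+-monoʳ-≤ (ι m) 0≤δ))
  (subst (ι m ℚ.+ δ ℚ.<_) (sym (ι-+ m 1ℤ)) (ℚP.+-monoʳ-< (ι m) δ<1))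

0ℚ<1ℚ : 0ℚ ℚ.< 1ℚ
0ℚ<1ℚ = *<* (+<+ (s≤s z≤n))

floor-ι : ∀ m → floor (ι m) ≡ m
floor-ι m = trans (cong floor (sym (ℚP.+-identityʳ (ι m)))) (floor-ι+ m (ℚP.≤-refl , 0ℚ<1ℚ))

p≤q⇒0≤q-p : ∀ {p q} → p ℚ.≤ q → 0ℚ ℚ.≤ q ℚ.- p
p≤q⇒0≤q-p {p} {q} p≤q = subst (ℚ._≤ q ℚ.- p) (ℚP.+-inverseʳ p) (ℚP.+-monoˡ-≤ (ℚ.- p) p≤q)

p<q⇒0<q-p : ∀ {p q} → p ℚ.< q → 0ℚ ℚ.< q ℚ.- p
p<q⇒0<q-p {p} {q} p<q = subst (ℚ._< q ℚ.- p) (ℚP.+-inverseʳ p) (ℚP.+-monoˡ-< (ℚ.- p) p<q)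

p<q⇒p-q<0 : ∀ {p q} → p ℚ.< q → p ℚ.- q ℚ.< 0ℚ
p<q⇒p-q<0 {p} {q} p<q = subst (p ℚ.- q ℚ.<_) (ℚP.+-inverseʳ q) (ℚP.+-monoˡ-< (ℚ.- q) p<q)

module _ {α β : ℚ} (α∈ : InUnit α) (β∈ : InUnit β) where

  unit-diff-<1 : β ℚ.- α ℚ.< 1ℚ
  unit-diff-<1 = ℚP.≤-<-trans (subst (β ℚ.- α ℚ.≤_) (ℚP.+-identityʳ β) (ℚP.+-monoʳ-≤ β (ℚP.neg-antimono-≤ (proj₁ α∈))))
                               (proj₂ β∈)

  -1<unit-diff : ℚ.- 1ℚ ℚ.< β ℚ.- α
  -1<unit-diff = ℚP.<-≤-trans (ℚP.neg-antimono-< (proj₂ α∈))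
                               (subst (ℚ._≤ β ℚ.- α) (ℚP.+-identityˡ (ℚ.- α)) (ℚP.+-monoˡ-≤ (ℚ.- α) (proj₁ β∈)))

  split-diff : ∀ A B → (ι B ℚ.+ β) ℚ.- (ι A ℚ.+ α) ≡ ι (B ℤ.- A) ℚ.+ (β ℚ.- α)
  split-diff A B = trans (solve 4 (λ b β a α → (b :+ β) :- (a :+ α) := (b :- a) :+ (β :- α)) refl (ι B) β (ι A) α)
                         (cong (ℚ._+ (β ℚ.- α)) (sym (ι-− B A)))
    where open +-*-Solver

  floor-unit-diff-≤ : ∀ A B → α ℚ.≤ β → floor ((ι B ℚ.+ β) ℚ.- (ι A ℚ.+ α)) ≡ B ℤ.- A
  floor-unit-diff-≤ A B α≤β = trans (cong floor (split-diff A B)) (floor-ι+ (B ℤ.- A) (p≤q⇒0≤q-p α≤β , unit-diff-<1))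

  -- Borrow 1 from the integer part: ι c + δ = ι (c - 1) + (1 + δ) with 0 ≤ 1 + δ < 1.
  floor-unit-diff-> : ∀ A B → β ℚ.< α → floor ((ι B ℚ.+ β) ℚ.- (ι A ℚ.+ α)) ≡ (B ℤ.- A) ℤ.- 1ℤ
  floor-unit-diff-> A B β<α = begin
    floor ((ι B ℚ.+ β) ℚ.- (ι A ℚ.+ α))       ≡⟨ cong floor (split-diff A B) ⟩
    floor (ι c ℚ.+ δ)                          ≡⟨ cong floor borrow ⟩
    floor (ι (c ℤ.- 1ℤ) ℚ.+ (1ℚ ℚ.+ δ))        ≡⟨ floor-ι+ (c ℤ.- 1ℤ) (0≤1+δ , 1+δ<1) ⟩
    c ℤ.- 1ℤ                                   ∎
    where
    open ≡-Reasoning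
    open +-*-Solver
    c = B ℤ.- A
    δ = β ℚ.- α
    borrow : ι c ℚ.+ δ ≡ ι (c ℤ.- 1ℤ) ℚ.+ (1ℚ ℚ.+ δ)
    borrow = trans (solve 2 (λ c δ → c :+ δ := (c :- con 1ℚ) :+ (con 1ℚ :+ δ)) refl (ι c) δ)
                   (cong (ℚ._+ (1ℚ ℚ.+ δ)) (sym (ι-− c 1ℤ)))
    0≤1+δ : 0ℚ ℚ.≤ 1ℚ ℚ.+ δ
    0≤1+δ = ℚP.<⇒≤ (subst (ℚ._< 1ℚ ℚ.+ δ) (ℚP.+-inverseʳ 1ℚ) (ℚP.+-monoʳ-< 1ℚ -1<unit-diff))
    1+δ<1 : 1ℚ ℚ.+ δ ℚ.< 1ℚ
    1+δ<1 = subst (1ℚ ℚ.+ δ ℚ.<_) (ℚP.+-identityʳ 1ℚ) (ℚP.+-monoʳ-< 1ℚ (p<q⇒p-q<0 β<α))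

  unit-diff-not-integer : ∀ A B m → α ≢ β → (ι B ℚ.+ β) ℚ.- (ι A ℚ.+ α) ≢ ι m
  unit-diff-not-integer A B m α≢β diff≡m = α≢β (sym (trans (solve 2 (λ β α → β := α :+ (β :- α)) refl β α) δ≡0))
    where
    open +-*-Solver
    c = B ℤ.- A
    δ≡ιk : β ℚ.- α ≡ ι (m ℤ.- c)
    δ≡ιk = begin
      β ℚ.- α                          ≡⟨ solve 2 (λ c δ → δ := (c :+ δ) :- c) refl (ι c) (β ℚ.- α) ⟩
      (ι c ℚ.+ (β ℚ.- α)) ℚ.- ι c      ≡⟨ cong (ℚ._- ι c) (trans (sym (split-diff A B)) diff≡m) ⟩
      ι m ℚ.- ι c                      ≡⟨ ι-− m c ⟨
      ι (m ℤ.- c)                      ∎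
      where open ≡-Reasoning
    k≡0 : ∀ k → ℤ.- 1ℤ ℤ.< k → k ℤ.< 1ℤ → k ≡ 0ℤ
    k≡0 (+ zero)        _          _                  = refl
    k≡0 (+ suc _)       _          (+<+ (s≤s ()))
    k≡0 -[1+ zero ]     (-<- ())   _
    k≡0 -[1+ suc _ ]    (-<- ())   _
    δ≡0 : α ℚ.+ (β ℚ.- α) ≡ α
    δ≡0 = trans (cong (α ℚ.+_) (trans δ≡ιk (cong ι (k≡0 (m ℤ.- c) (ι-cancel-< (subst (ℚ.- 1ℚ ℚ.<_) δ≡ιk -1<unit-diff))
                                                     (ι-cancel-< (subst (ℚ._< 1ℚ) δ≡ιk unit-diff-<1))))))
                (ℚP.+-identityʳ α)

-- The alcove of a generic point

pair-inner : ∀ {d a b} → 1 ≤ a → a < b → b ≤ suc d → Pair d a b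
pair-inner 1≤a a<b b≤1+d = a<b , b≤1+d , λ (a≡0 , _) → <-irrefl (sym a≡0) 1≤a

pair-first : ∀ {d j} → 1 ≤ j → j ≤ d → Pair d 0 j
pair-first 1≤j j≤d = 1≤j , m≤n⇒m≤1+n j≤d , λ (_ , j≡1+d) → <-irrefl refl (subst (_≤ _) j≡1+d j≤d)

pair-step : ∀ {d j} → 1 ≤ d → j < suc d → Pair d j (suc j)
pair-step 1≤d j<1+d = ≤-refl , j<1+d ,
  λ (j≡0 , 1+j≡1+d) → <-irrefl refl (subst (1 ≤_) (trans (suc-injective (sym 1+j≡1+d)) j≡0) 1≤d)

module Alcove (d r : ℕ) (d≥1 : 1 ≤ d) (p : QPoint d) (gen : GenericInterior r d p) where

  ℓ : ℕ → ℕ → ℤ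
  ℓ a b = floor (Lℚ p a b)

  p≥0 : ∀ k → 0ℚ ℚ.≤ lookup p k
  p≥0 k = ℚP.<⇒≤ (proj₁ (proj₂ gen) k)

  ℓ-nonneg : ∀ a b → a < b → 0ℤ ℤ.≤ ℓ a b
  ℓ-nonneg a b a<b = floor-nonneg _ (p≤q⇒0≤q-p (psumℚ-mono p p≥0 a b (<⇒≤ a<b)))

  -- Opaque: letting the typechecker unfold floors of symbolic rationals makes it blow up.
  opaque
    y : ℕ → ℚ
    y = psumℚ p

    f : ℕ → ℤ
    f j = floor (y j)

    fN : ℕ → ℕ
    fN j = ℤ.∣ f j ∣

    φ : ℕ → ℚ
    φ j = y j ℚ.- ι (f j)

    fN-0 : fN 0 ≡ 0
    fN-0 = refl

    φ-0 : φ 0 ≡ 0ℚ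
    φ-0 = refl

    +fN≡f : ∀ j → + fN j ≡ f j
    +fN≡f j = ℤP.0≤i⇒+∣i∣≡i (floor-nonneg (y j) (psumℚ-nonneg p p≥0 j))

    y≡fN+φ : ∀ j → y j ≡ ι (+ fN j) ℚ.+ φ j
    y≡fN+φ j = trans (solve 2 (λ y z → y := z :+ (y :- z)) refl (y j) (ι (f j)))
                     (cong (λ z → ι z ℚ.+ φ j) (sym (+fN≡f j)))
      where open +-*-Solver

    φ-unit : ∀ j → InUnit (φ j)
    φ-unit j = p≤q⇒0≤q-p (floor-≤ (y j)) , subst (φ j ℚ.<_) cancel (ℚP.+-monoˡ-< (ℚ.- ι (f j)) y<f+1)
      where
      open +-*-Solver
      y<f+1 : y j ℚ.< ι (f j) ℚ.+ 1ℚ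
      y<f+1 = subst (y j ℚ.<_) (ι-+ (f j) 1ℤ) (<-floor+1 (y j))
      cancel : (ι (f j) ℚ.+ 1ℚ) ℚ.- ι (f j) ≡ 1ℚ
      cancel = solve 1 (λ z → (z :+ con 1ℚ) :- z := con 1ℚ) refl (ι (f j))

    f-top : f (suc d) ≡ + r
    f-top = trans (cong floor (proj₁ gen)) (floor-ι (+ r))

    φ-top : φ (suc d) ≡ 0ℚ
    φ-top = trans (cong₂ (λ u v → u ℚ.- ι v) (proj₁ gen) f-top) (ℚP.+-inverseʳ (ι (+ r)))

    Lℚ-split : ∀ a b → Lℚ p a b ≡ (ι (+ fN b) ℚ.+ φ b) ℚ.- (ι (+ fN a) ℚ.+ φ a)
    Lℚ-split a b = cong₂ ℚ._-_ (y≡fN+φ b) (y≡fN+φ a)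

    +fN≡floor : ∀ j → + fN j ≡ floor (psumℚ p j)
    +fN≡floor = +fN≡f

    φ-unfold : ∀ j → φ j ≡ psumℚ p j ℚ.- ι (floor (psumℚ p j))
    φ-unfold j = refl

  fN-top : fN (suc d) ≡ r
  fN-top = cong ℤ.∣_∣ (trans (+fN≡f (suc d)) f-top)

  φ-injective : ∀ a b → Pair d a b → φ a ≢ φ b
  φ-injective a b ab φa≡φb = proj₂ (proj₂ gen) a b ab (+ fN b ℤ.- + fN a , L≡ι)
    where
    L≡ι : Lℚ p a b ≡ ι (+ fN b ℤ.- + fN a)
    L≡ι = begin
      Lℚ p a b                                           ≡⟨ Lℚ-split a b ⟩
      (ι (+ fN b) ℚ.+ φ b) ℚ.- (ι (+ fN a) ℚ.+ φ a)      ≡⟨ split-diff (φ-unit a) (φ-unit b) (+ fN a) (+ fN b) ⟩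
      ι (+ fN b ℤ.- + fN a) ℚ.+ (φ b ℚ.- φ a)            ≡⟨ cong (λ z → ι (+ fN b ℤ.- + fN a) ℚ.+ (φ b ℚ.- z)) φa≡φb ⟩
      ι (+ fN b ℤ.- + fN a) ℚ.+ (φ b ℚ.- φ b)            ≡⟨ cong (ι (+ fN b ℤ.- + fN a) ℚ.+_) (ℚP.+-inverseʳ (φ b)) ⟩
      ι (+ fN b ℤ.- + fN a) ℚ.+ 0ℚ                       ≡⟨ ℚP.+-identityʳ _ ⟩
      ι (+ fN b ℤ.- + fN a)                              ∎
      where open ≡-Reasoning

  φ-pos : ∀ j → 1 ≤ j → j ≤ d → 0ℚ ℚ.< φ j
  φ-pos j 1≤j j≤d with ℚP.<-cmp 0ℚ (φ j)
  ... | tri< 0<φj _ _ = 0<φj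
  ... | tri≈ _ 0≡φj _ = ⊥-elim (φ-injective 0 j (pair-first 1≤j j≤d) (trans φ-0 0≡φj))
  ... | tri> _ _ φj<0 = ⊥-elim (ℚP.<-irrefl refl (ℚP.<-≤-trans φj<0 (proj₁ (φ-unit j))))

  ℓ-≤ : ∀ a b → φ a ℚ.≤ φ b → ℓ a b ≡ + fN b ℤ.- + fN a
  ℓ-≤ a b φa≤φb = trans (cong floor (Lℚ-split a b)) (floor-unit-diff-≤ (φ-unit a) (φ-unit b) (+ fN a) (+ fN b) φa≤φb)

  ℓ-> : ∀ a b → φ b ℚ.< φ a → ℓ a b ≡ (+ fN b ℤ.- + fN a) ℤ.- 1ℤ
  ℓ-> a b φb<φa = trans (cong floor (Lℚ-split a b)) (floor-unit-diff-> (φ-unit a) (φ-unit b) (+ fN a) (+ fN b) φb<φa)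


  key : ℕ → ℚ
  key t = φ (suc t)

  key-injective : ∀ a b → a < d → b < d → a ≢ b → key a ≢ key b
  key-injective a b a<d b<d a≢b with <-cmp a b
  ... | tri< a<b _ _ = φ-injective (suc a) (suc b) (pair-inner (s≤s z≤n) (s≤s a<b) (s≤s (<⇒≤ b<d)))
  ... | tri≈ _ a≡b _ = ⊥-elim (a≢b a≡b)
  ... | tri> _ _ b<a = φ-injective (suc b) (suc a) (pair-inner (s≤s z≤n) (s≤s b<a) (s≤s (<⇒≤ a<d))) ∘ sym

  open Ranking d key key-injective public

  -- Vertex i rounds y j up exactly when φ j has rank at least i among φ 1, …, φ d (ranks counted from 0).
  excess : ℕ → ℕ → ℕ
  excess i zero    = 0
  excess i (suc t) with t <? d
  ... | yes _ = 𝟙[ i ≤ rank t ]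
  ... | no  _ = 0

  excess-inner : ∀ i t → t < d → excess i (suc t) ≡ 𝟙[ i ≤ rank t ]
  excess-inner i t t<d with t <? d
  ... | yes _   = refl
  ... | no  t≮d = ⊥-elim (t≮d t<d)

  excess-top : ∀ i → excess i (suc d) ≡ 0
  excess-top i with d <? d
  ... | yes d<d = ⊥-elim (<-irrefl refl d<d)
  ... | no  _   = refl

  excess-≤1 : ∀ i j → excess i j ≤ 1
  excess-≤1 i zero    = z≤n
  excess-≤1 i (suc t) with t <? d
  ... | yes _ = 𝟙-≤1 i (rank t)
  ... | no  _ = z≤n

  excess-antiˡ : ∀ {i i′} j → i ≤ i′ → excess i′ j ≤ excess i j
  excess-antiˡ zero    _    = z≤n
  excess-antiˡ (suc t) i≤i′ with t <? d
  ... | yes _ = 𝟙-antiˡ (rank t) i≤i′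
  ... | no  _ = z≤n

  excess-mono : ∀ i a b → b ≤ suc d → φ a ℚ.< φ b → excess i a ≤ excess i b
  excess-mono i zero    b _   _     = z≤n
  excess-mono i (suc t) b b≤1+d φa<φb with t <? d
  ... | no  _   = z≤n
  ... | yes t<d = atLeast b b≤1+d φa<φb
    where
    0<φa : 0ℚ ℚ.< φ (suc t)
    0<φa = φ-pos (suc t) (s≤s z≤n) t<d
    atLeast : ∀ b → b ≤ suc d → φ (suc t) ℚ.< φ b → 𝟙[ i ≤ rank t ] ≤ excess i b
    atLeast zero     _      φa<φ0 = ⊥-elim (ℚP.<-asym 0<φa (subst (φ (suc t) ℚ.<_) φ-0 φa<φ0))
    atLeast (suc t′) t′≤d φa<φb with t′ <? d
    ... | yes t′<d = 𝟙-monoʳ i (<⇒≤ (rank-ranks t t′ t<d t′<d φa<φb))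
    ... | no  t′≮d = ⊥-elim (ℚP.<-asym 0<φa (subst (φ (suc t) ℚ.<_) φb≡0 φa<φb))
      where
      φb≡0 : φ (suc t′) ≡ 0ℚ
      φb≡0 = trans (cong (φ ∘ suc) (≤-antisym (≤-pred t′≤d) (≮⇒≥ t′≮d))) φ-top

  vertexPsum : ℕ → ℕ → ℕ
  vertexPsum i j = fN j + excess i j

  InCell : (ℕ → ℕ) → Set
  InCell Z = ∀ a b → Pair d a b → (ℓ a b ℤ.≤ + Z b ℤ.- + Z a) × (+ Z b ℤ.- + Z a ℤ.≤ ℓ a b ℤ.+ 1ℤ)

  vertexPsum-inCell : ∀ i → InCell (vertexPsum i)
  vertexPsum-inCell i a b ab@(a<b , b≤1+d , _) with ℚP.<-cmp (φ a) (φ b)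
  ... | tri< φa<φb _ _ = subst (λ m → (m ℤ.≤ diff) × (diff ℤ.≤ m ℤ.+ 1ℤ)) (sym (ℓ-≤ a b (ℚP.<⇒≤ φa<φb)))
                           (≤⇒diff-between (excess-mono i a b b≤1+d φa<φb) (excess-≤1 i b))
    where
    open ExcessDifference (fN a) (fN b) (excess i a) (excess i b)
    diff = + vertexPsum i b ℤ.- + vertexPsum i a
  ... | tri≈ _ φa≡φb _ = ⊥-elim (φ-injective a b ab φa≡φb)
  ... | tri> _ _ φb<φa = subst (λ m → (m ℤ.≤ diff) × (diff ℤ.≤ m ℤ.+ 1ℤ)) (sym (ℓ-> a b φb<φa))
                           (≥⇒diff-between (excess-mono i b a (<⇒≤ (<-≤-trans a<b b≤1+d)) φb<φa) (excess-≤1 i a))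
    where
    open ExcessDifference (fN a) (fN b) (excess i a) (excess i b)
    diff = + vertexPsum i b ℤ.- + vertexPsum i a

  InCell-cong : ∀ {Z Z′} → (∀ j → j ≤ suc d → Z j ≡ Z′ j) → InCell Z → InCell Z′
  InCell-cong Z≡Z′ cell a b ab@(a<b , b≤1+d , _) =
    subst₂ (λ u v → (ℓ a b ℤ.≤ + v ℤ.- + u) × (+ v ℤ.- + u ℤ.≤ ℓ a b ℤ.+ 1ℤ))
           (Z≡Z′ a (<⇒≤ (<-≤-trans a<b b≤1+d))) (Z≡Z′ b b≤1+d) (cell a b ab)

  inCell⇒mono : ∀ {Z} → InCell Z → ∀ j → j < suc d → Z j ≤ Z (suc j)
  inCell⇒mono cell j j<1+d = 0≤+n-+m⇒m≤n (ℤP.≤-trans (ℓ-nonneg j (suc j) ≤-refl) (proj₁ (cell j (suc j) (pair-step d≥1 j<1+d))))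

  vertexPsum-0 : ∀ i → vertexPsum i 0 ≡ 0
  vertexPsum-0 i = trans (+-identityʳ (fN 0)) fN-0

  vertex : ℕ → Point d
  vertex i = fromPsumsℕ (suc d) (vertexPsum i)

  psum-vertex : ∀ i j → j ≤ suc d → psumℕ (vertex i) j ≡ vertexPsum i j
  psum-vertex i = psumℕ-fromPsumsℕ (suc d) (vertexPsum i) (vertexPsum-0 i) (inCell⇒mono (vertexPsum-inCell i))

  vertexPsum-top : ∀ i → vertexPsum i (suc d) ≡ r
  vertexPsum-top i = trans (cong₂ _+_ fN-top (excess-top i)) (+-identityʳ r)

  vertex-sum : ∀ i → psumℕ (vertex i) (suc d) ≡ r
  vertex-sum i = trans (psum-vertex i (suc d) ≤-refl) (vertexPsum-top i)

  vertex-inClosedCell : ∀ i → InClosedCell r d p (vertex i)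
  vertex-inClosedCell i = vertex-sum i , InCell-cong (λ j j≤1+d → sym (psum-vertex i j j≤1+d)) (vertexPsum-inCell i)

  module _ (x : Point d) (x-top : psumℕ x (suc d) ≡ r) (x-cell : InCell (psumℕ x)) where
    private
      Z : ℕ → ℕ
      Z = psumℕ x

      fN≤Z≤1+fN : ∀ j → 1 ≤ j → j ≤ d → fN j ≤ Z j × Z j ≤ suc (fN j)
      fN≤Z≤1+fN j 1≤j j≤d with x-cell 0 j (pair-first 1≤j j≤d)
      ... | ℓ≤Z , Z≤ℓ+1 = ℤP.drop‿+≤+ (subst₂ ℤ._≤_ ℓ0j≡fNj (ℤP.+-identityʳ (+ Z j)) ℓ≤Z)
                        , ℤP.drop‿+≤+ (subst₂ ℤ._≤_ (ℤP.+-identityʳ (+ Z j))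
                                                    (trans (cong (ℤ._+ 1ℤ) ℓ0j≡fNj) (ℤP.+-comm (+ fN j) 1ℤ)) Z≤ℓ+1)
        where
        ℓ0j≡fNj : ℓ 0 j ≡ + fN j
        ℓ0j≡fNj = trans (ℓ-≤ 0 j (subst (ℚ._≤ φ j) (sym φ-0) (proj₁ (φ-unit j))))
                        (trans (cong (λ n → + fN j ℤ.- + n) fN-0) (ℤP.+-identityʳ (+ fN j)))

      e : ℕ → ℕ
      e j = Z j ∸ fN j

      Z≡fN+e : ∀ j → 1 ≤ j → j ≤ d → Z j ≡ fN j + e j
      Z≡fN+e j 1≤j j≤d = sym (m+[n∸m]≡n (proj₁ (fN≤Z≤1+fN j 1≤j j≤d)))

      e≤1 : ∀ j → 1 ≤ j → j ≤ d → e j ≤ 1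
      e≤1 j 1≤j j≤d = +-cancelˡ-≤ (fN j) _ _
        (subst₂ _≤_ (Z≡fN+e j 1≤j j≤d) (+-comm 1 (fN j)) (proj₂ (fN≤Z≤1+fN j 1≤j j≤d)))

      e-mono : ∀ a b → 1 ≤ a → a ≤ d → 1 ≤ b → b ≤ d → φ a ℚ.< φ b → e a ≤ e b
      e-mono a b 1≤a a≤d 1≤b b≤d φa<φb with <-cmp a b
      ... | tri< a<b _ _ = ≤diff⇒≤ (subst₂ ℤ._≤_ (ℓ-≤ a b (ℚP.<⇒≤ φa<φb))
                                               (cong₂ (λ u v → + u ℤ.- + v) (Z≡fN+e b 1≤b b≤d) (Z≡fN+e a 1≤a a≤d))
                                   (proj₁ (x-cell a b (pair-inner 1≤a a<b (m≤n⇒m≤1+n b≤d)))))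
        where open ExcessDifference (fN a) (fN b) (e a) (e b)
      ... | tri≈ _ a≡b _ = ⊥-elim (ℚP.<-irrefl (cong φ a≡b) φa<φb)
      ... | tri> _ _ b<a = diff≤⇒≥ (subst₂ ℤ._≤_ (cong₂ (λ u v → + u ℤ.- + v) (Z≡fN+e a 1≤a a≤d) (Z≡fN+e b 1≤b b≤d))
                                               (cong (ℤ._+ 1ℤ) (ℓ-> b a φa<φb))
                                   (proj₂ (x-cell b a (pair-inner 1≤b b<a (m≤n⇒m≤1+n a≤d)))))
        where open ExcessDifference (fN b) (fN a) (e b) (e a)

      step : ∃ λ k → k ≤ d × (∀ i → i < d → e (suc (unrank i)) ≡ 𝟙[ k ≤ i ])
      step = monotone01⇒step d (λ i → e (suc (unrank i))) (λ i i<d → e≤1 _ (s≤s z≤n) (h-< i i<d))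
        λ i i′ i′<d i<i′ → e-mono _ _ (s≤s z≤n) (h-< i (<-trans i<i′ i′<d)) (s≤s z≤n) (h-< i′ i′<d)
                                  (ranks⇒lists inverse keyOrder-strictTotal rank-ranks i i′ i′<d i<i′)
        where open InverseOn inverse

      Z≡vertexPsum : ∀ k → (∀ i → i < d → e (suc (unrank i)) ≡ 𝟙[ k ≤ i ]) → ∀ j → j ≤ suc d → Z j ≡ vertexPsum k j
      Z≡vertexPsum k e≡step zero    _ = sym (vertexPsum-0 k)
      Z≡vertexPsum k e≡step (suc t) t<1+d with m≤n⇒m<n∨m≡n (≤-pred t<1+d)
      ... | inj₂ refl = trans x-top (sym (vertexPsum-top k))
      ... | inj₁ t<d  = begin
        Z (suc t)                               ≡⟨ Z≡fN+e (suc t) (s≤s z≤n) t<d ⟩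
        fN (suc t) + e (suc t)                  ≡⟨ cong (λ u → fN (suc t) + e (suc u)) (h∘g t t<d) ⟨
        fN (suc t) + e (suc (unrank (rank t)))  ≡⟨ cong (_+_ (fN (suc t))) (e≡step (rank t) (g-< t t<d)) ⟩
        fN (suc t) + 𝟙[ k ≤ rank t ]            ≡⟨ cong (_+_ (fN (suc t))) (excess-inner k t t<d) ⟨
        vertexPsum k (suc t)                    ∎
        where
        open ≡-Reasoning
        open InverseOn inverse

    inClosedCell⇒vertex : ∃ λ i → i ≤ d × x ≡ vertex i
    inClosedCell⇒vertex = x≡vertex step
      where
      x≡vertex : (∃ λ k → k ≤ d × (∀ i → i < d → e (suc (unrank i)) ≡ 𝟙[ k ≤ i ])) → ∃ λ i → i ≤ d × x ≡ vertex i
      x≡vertex (k , k≤d , e≡step) = k , k≤d , psumℕ-injective x (vertex k)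
        (λ j j≤1+d → trans (Z≡vertexPsum k e≡step j j≤1+d) (sym (psum-vertex k j j≤1+d)))

  fN<r : ∀ j → 1 ≤ j → j ≤ d → fN j < r
  fN<r j 1≤j j≤d = subst (fN j <_) fN-top
    (0≤+n-+m-1⇒m<n (subst (0ℤ ℤ.≤_) (ℓ-> j (suc d) φ-top<φj) (ℓ-nonneg j (suc d) (s≤s j≤d))))
    where
    φ-top<φj : φ (suc d) ℚ.< φ j
    φ-top<φj = subst (ℚ._< φ j) (sym φ-top) (φ-pos j 1≤j j≤d)

  rowEntry : ℕ → ℕ → ℕ
  rowEntry i c = count d (λ t → vertexPsum i (suc t) ≤? c)

  entry-vertex : ∀ i c → c < r → entry (vertex i) c ≡ rowEntry i c
  entry-vertex i c c<r = trans (entry≡count d (vertex i) c c<Σ) (count-cong d _ _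
      (λ t t<d → subst (_≤ c) (psum-vertex i (suc t) (s≤s (<⇒≤ t<d))))
      (λ t t<d → subst (_≤ c) (sym (psum-vertex i (suc t) (s≤s (<⇒≤ t<d))))))
    where
    c<Σ : c < sum (Vec.toList (vertex i))
    c<Σ = subst (c <_) (trans (sym (vertex-sum i)) (psumℕ-total (vertex i))) c<r

  rowEntry-mono : ∀ {i i′} c → i ≤ i′ → rowEntry i c ≤ rowEntry i′ c
  rowEntry-mono c i≤i′ = count-mono d _ _ λ t _ → ≤-trans (+-monoʳ-≤ (fN (suc t)) (excess-antiˡ (suc t) i≤i′))

  letter : ℕ → ℕ
  letter i = fN (suc (unrank i))

  letter<r : ∀ i → i < d → letter i < r
  letter<r i i<d = fN<r (suc (unrank i)) (s≤s z≤n) (InverseOn.h-< inverse i i<d)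

  vertexPsum-unrank : ∀ i′ i → i < d → vertexPsum i′ (suc (unrank i)) ≡ letter i + 𝟙[ i′ ≤ i ]
  vertexPsum-unrank i′ i i<d = cong (_+_ (letter i)) (trans (excess-inner i′ (unrank i) (h-< i i<d)) (cong 𝟙[ i′ ≤_] (g∘h i i<d)))
    where open InverseOn inverse

  vertexPsum-unrank-≤ : ∀ i → i < d → vertexPsum i (suc (unrank i)) ≡ suc (letter i)
  vertexPsum-unrank-≤ i i<d = trans (vertexPsum-unrank i i i<d) (trans (cong (_+_ (letter i)) (𝟙-yes ≤-refl)) (+-comm (letter i) 1))

  vertexPsum-unrank-> : ∀ i → i < d → vertexPsum (suc i) (suc (unrank i)) ≡ letter i
  vertexPsum-unrank-> i i<d = trans (vertexPsum-unrank (suc i) i i<d) (trans (cong (_+_ (letter i)) (𝟙-no ≤-refl)) (+-identityʳ (letter i)))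

  rowEntry-jump : ∀ i → i < d → rowEntry i (letter i) < rowEntry (suc i) (letter i)
  rowEntry-jump i i<d = count-mono-< d _ _ (λ t _ → ≤-trans (+-monoʳ-≤ (fN (suc t)) (excess-antiˡ (suc t) (n≤1+n i))))
    (unrank i) (InverseOn.h-< inverse i i<d)
    (λ ≤letter → 1+n≰n (subst (_≤ letter i) (vertexPsum-unrank-≤ i i<d) ≤letter))
    (≤-reflexive (vertexPsum-unrank-> i i<d))

  rowEntry-flat : ∀ i c → i < d → c ≢ letter i → rowEntry (suc i) c ≤ rowEntry i c
  rowEntry-flat i c i<d c≢letter = count-mono d _ _ below
    where
    open InverseOn inverse
    below : ∀ t → t < d → vertexPsum (suc i) (suc t) ≤ c → vertexPsum i (suc t) ≤ c
    below t t<d ≤c with t ≟ unrank i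
    ... | yes refl = subst (_≤ c) (sym (vertexPsum-unrank-≤ i i<d))
                       (≤∧≢⇒< letter≤c (c≢letter ∘ sym))
      where
      letter≤c : letter i ≤ c
      letter≤c = subst (_≤ c) (vertexPsum-unrank-> i i<d) ≤c
    ... | no t≢unrank = subst (_≤ c) (cong (_+_ (fN (suc t))) same-excess) ≤c
      where
      same-excess : excess (suc i) (suc t) ≡ excess i (suc t)
      same-excess = begin
        excess (suc i) (suc t)  ≡⟨ excess-inner (suc i) t t<d ⟩
        𝟙[ suc i ≤ rank t ]     ≡⟨ 𝟙-suc (λ rank≡i → t≢unrank (trans (sym (h∘g t t<d)) (cong unrank rank≡i))) ⟩
        𝟙[ i ≤ rank t ]         ≡⟨ excess-inner i t t<d ⟨
        excess i (suc t)        ∎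
        where open ≡-Reasoning

  -- There are no bottom marks.
  rowEntry-wrap : ∀ c → rowEntry d c ≡ rowEntry 0 (suc c)
  rowEntry-wrap c = count-cong d _ _ (λ t t<d ≤c → subst (_≤ suc c) (sym (psum0 t t<d)) (s≤s (subst (_≤ c) (psum-last t t<d) ≤c)))
                              (λ t t<d ≤1+c → subst (_≤ c) (sym (psum-last t t<d)) (≤-pred (subst (_≤ suc c) (psum0 t t<d) ≤1+c)))
    where
    psum-last : ∀ t → t < d → vertexPsum d (suc t) ≡ fN (suc t)
    psum-last t t<d = trans (cong (_+_ (fN (suc t))) (trans (excess-inner d t t<d) (𝟙-no (rank-< t t<d)))) (+-identityʳ _)
    psum0 : ∀ t → t < d → vertexPsum 0 (suc t) ≡ suc (fN (suc t))
    psum0 t t<d = trans (cong (_+_ (fN (suc t))) (trans (excess-inner 0 t t<d) (𝟙-yes {k = rank t} z≤n))) (+-comm _ 1)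

  rowEntry-chain : ∀ l k → l < k → k ≤ d → rowEntry l (letter l) < rowEntry k (letter l)
  rowEntry-chain l k l<k k≤d = <-≤-trans (rowEntry-jump l (<-≤-trans l<k k≤d)) (rowEntry-mono (letter l) l<k)

  rowEntry-dominated⇒< : ∀ k l → k ≤ d → k ≢ l → (∀ c → c < r → rowEntry k c ≤ rowEntry l c) → k < l
  rowEntry-dominated⇒< k l k≤d k≢l k≼l with <-cmp k l
  ... | tri< k<l _ _ = k<l
  ... | tri≈ _ k≡l _ = ⊥-elim (k≢l k≡l)
  ... | tri> _ _ l<k = ⊥-elim (<⇒≱ (rowEntry-chain l k l<k k≤d) (k≼l (letter l) (letter<r l (<-≤-trans l<k k≤d))))

  vertex≡⇒rowEntry≡ : ∀ {i j c} → vertex i ≡ vertex j → c < r → rowEntry i c ≡ rowEntry j c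
  vertex≡⇒rowEntry≡ {i} {j} {c} vi≡vj c<r =
    trans (sym (entry-vertex i c c<r)) (trans (cong (λ v → entry v c) vi≡vj) (entry-vertex j c c<r))

  vertex-injective : ∀ i j → i ≤ d → j ≤ d → vertex i ≡ vertex j → i ≡ j
  vertex-injective i j i≤d j≤d vi≡vj with <-cmp i j
  ... | tri< i<j _ _ = ⊥-elim (<-irrefl (vertex≡⇒rowEntry≡ vi≡vj (letter<r i (<-≤-trans i<j j≤d))) (rowEntry-chain i j i<j j≤d))
  ... | tri≈ _ i≡j _ = i≡j
  ... | tri> _ _ j<i = ⊥-elim (<-irrefl (vertex≡⇒rowEntry≡ (sym vi≡vj) (letter<r j (<-≤-trans j<i i≤d))) (rowEntry-chain j i j<i i≤d))

  lex : LexIncreasing d (fN ∘ suc) rank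
  lex t t′ t<t′ t′<d with ℚP.<-cmp (φ (suc t)) (φ (suc t′))
  ... | tri< φ<φ′ _ _ =
    Sum.map₂ (λ fN≡fN′ → fN≡fN′ , rank-ranks t t′ (<-trans t<t′ t′<d) t′<d φ<φ′) (m≤n⇒m<n∨m≡n fN≤fN′)
    where
    fN≤fN′ : fN (suc t) ≤ fN (suc t′)
    fN≤fN′ = 0≤+n-+m⇒m≤n (subst (0ℤ ℤ.≤_) (ℓ-≤ (suc t) (suc t′) (ℚP.<⇒≤ φ<φ′))
                                          (ℓ-nonneg (suc t) (suc t′) (s≤s t<t′)))
  ... | tri≈ _ φ≡φ′ _ =
    ⊥-elim (φ-injective (suc t) (suc t′) (pair-inner (s≤s z≤n) (s≤s t<t′) (s≤s (<⇒≤ t′<d))) φ≡φ′)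
  ... | tri> _ _ φ′<φ =
    inj₁ (0≤+n-+m-1⇒m<n (subst (0ℤ ℤ.≤_) (ℓ-> (suc t) (suc t′) φ′<φ) (ℓ-nonneg (suc t) (suc t′) (s≤s t<t′))))

  rows : Rows d
  rows i = vertex (toℕ i)

  entry-row : ∀ i c → c < r → entry (rows i) c ≡ rowEntry (toℕ i) c
  entry-row i = entry-vertex (toℕ i)

  entry-row-inject₁ : ∀ (i : Fin d) c → c < r → entry (rows (inject₁ i)) c ≡ rowEntry (toℕ i) c
  entry-row-inject₁ i c c<r = trans (entry-row (inject₁ i) c c<r) (cong (λ k → rowEntry k c) (FP.toℕ-inject₁ i))

  rows-sorted : Sorted r d rows
  rows-sorted = down , wrap
    where
    down : ∀ (i : Fin d) b → b < r → entry (rows (inject₁ i)) b ≤ entry (rows (F.suc i)) b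
    down i b b<r = subst₂ _≤_ (sym (entry-row-inject₁ i b b<r)) (sym (entry-row (F.suc i) b b<r)) (rowEntry-mono b (n≤1+n (toℕ i)))
    wrap : ∀ b → suc b < r → entry (rows (fromℕ d)) b ≤ entry (rows F.zero) (suc b)
    wrap b 1+b<r = subst₂ _≤_ (sym (trans (entry-row (fromℕ d) b (<-trans (n<1+n b) 1+b<r)) (cong (λ k → rowEntry k b) (FP.toℕ-fromℕ d))))
                              (sym (entry-row F.zero (suc b) 1+b<r)) (≤-reflexive (rowEntry-wrap b))

  word : Vec (Fin r) d
  word = tabulate λ i → fromℕ< (letter<r (toℕ i) (FP.toℕ<n i))

  toℕ-word : ∀ i → toℕ (lookup word i) ≡ letter (toℕ i)
  toℕ-word i = trans (cong toℕ (VP.lookup∘tabulate _ i)) (FP.toℕ-fromℕ< _)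

  letter≡toℕ-word : ∀ i (i<d : i < d) → letter i ≡ toℕ (lookup word (fromℕ< i<d))
  letter≡toℕ-word i i<d = trans (cong letter (sym (FP.toℕ-fromℕ< i<d))) (sym (toℕ-word (fromℕ< i<d)))

  rows-marked : ∀ (i : Fin d) → Marked d rows i (letter (toℕ i))
  rows-marked i = subst₂ _<_ (sym (entry-row-inject₁ i _ letter<r′)) (sym (entry-row (F.suc i) _ letter<r′))
                             (rowEntry-jump (toℕ i) (FP.toℕ<n i))
    where letter<r′ = letter<r (toℕ i) (FP.toℕ<n i)

  rows-unmarked : ∀ (i : Fin d) b → b < r → b ≢ letter (toℕ i) → ¬ Marked d rows i b
  rows-unmarked i b b<r b≢letter marked =
    <⇒≱ (subst₂ _<_ (entry-row-inject₁ i b b<r) (entry-row (F.suc i) b b<r) marked) (rowEntry-flat (toℕ i) b (FP.toℕ<n i) b≢letter)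

  marked⇒letter : ∀ (i : Fin d) b → b < r → Marked d rows i b → b ≡ letter (toℕ i)
  marked⇒letter i b b<r marked with b ≟ letter (toℕ i)
  ... | yes b≡letter = b≡letter
  ... | no  b≢letter = ⊥-elim (rows-unmarked i b b<r b≢letter marked)

  vertexPsum-inner : ∀ i t → t < d → vertexPsum i (suc t) ≡ fN (suc t) + 𝟙[ i ≤ rank t ]
  vertexPsum-inner i t t<d = cong (_+_ (fN (suc t))) (excess-inner i t t<d)

  rows-injective : ∀ i j → rows i ≡ rows j → i ≡ j
  rows-injective i j ri≡rj = FP.toℕ-injective (vertex-injective (toℕ i) (toℕ j) (≤-pred (FP.toℕ<n i)) (≤-pred (FP.toℕ<n j)) ri≡rj)

  module Enumeration (S : Point d → Set) (S⇔cell : ∀ x → S x ⇔ InClosedCell r d p x) where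

    rows-enumerate : ∀ x → S x ⇔ ∃ λ i → rows i ≡ x
    rows-enumerate x = mk⇔ to from
      where
      toRow : (∃ λ i → i ≤ d × x ≡ vertex i) → ∃ λ i → rows i ≡ x
      toRow (i , i≤d , x≡vi) = fromℕ< (s≤s i≤d) , trans (cong vertex (FP.toℕ-fromℕ< (s≤s i≤d))) (sym x≡vi)
      to : S x → ∃ λ i → rows i ≡ x
      to sx = toRow (inClosedCell⇒vertex x (proj₁ cell) (proj₂ cell))
        where cell = Equivalence.to (S⇔cell x) sx
      from : (∃ λ i → rows i ≡ x) → S x
      from (i , refl) = Equivalence.from (S⇔cell (rows i)) (vertex-inClosedCell (toℕ i))

    rows-sortedEnumeration : SortedEnumeration r d S rows
    rows-sortedEnumeration = rows-enumerate , rows-injective , rows-sorted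

    isWord : IsWord₁ r d S word
    isWord = rows , rows-sortedEnumeration , λ i →
        subst (Marked d rows i) (sym (toℕ-word i)) (rows-marked i)
      , λ b b<r b≢w → rows-unmarked i b b<r (λ b≡letter → b≢w (trans b≡letter (sym (toℕ-word i))))

    sortedEnumeration-unique : ∀ {V} → SortedEnumeration r d S V → ∀ a → V a ≡ rows a
    sortedEnumeration-unique {V} (V-enumerates , V-injective , V-sorted) a =
      trans (sym (position-row a)) (cong rows (strictMono⇒id-Fin position position-mono a))
      where
      located : ∀ a → ∃ λ i → rows i ≡ V a
      located a = Equivalence.to (rows-enumerate (V a)) (Equivalence.from (V-enumerates (V a)) (a , refl))
      position : Fin (suc d) → Fin (suc d)
      position a = proj₁ (located a)
      position-row : ∀ a → rows (position a) ≡ V a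
      position-row a = proj₂ (located a)
      rowEntry-position : ∀ a c → c < r → rowEntry (toℕ (position a)) c ≡ entry (V a) c
      rowEntry-position a c c<r = trans (sym (entry-row (position a) c c<r)) (cong (λ v → entry v c) (position-row a))
      position-mono : ∀ (a : Fin d) → toℕ (position (inject₁ a)) < toℕ (position (F.suc a))
      position-mono a = rowEntry-dominated⇒< _ _ (≤-pred (FP.toℕ<n (position (inject₁ a)))) distinct
        λ c c<r → subst₂ _≤_ (sym (rowEntry-position (inject₁ a) c c<r)) (sym (rowEntry-position (F.suc a) c c<r)) (proj₁ V-sorted a c c<r)
        where
        distinct : toℕ (position (inject₁ a)) ≢ toℕ (position (F.suc a))
        distinct eq = 1+n≢n (sym (trans (sym (FP.toℕ-inject₁ a)) (cong toℕ (V-injective _ _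
          (trans (sym (position-row (inject₁ a))) (trans (cong rows (FP.toℕ-injective eq)) (position-row (F.suc a))))))))

    word-unique : ∀ w → IsWord₁ r d S w → w ≡ word
    word-unique w (V , V-sortedEnumeration , V-marks) =
      lookup-ext λ i → FP.toℕ-injective (trans (marked-letter i) (sym (toℕ-word i)))
      where
      marked-letter : ∀ i → toℕ (lookup w i) ≡ letter (toℕ i)
      marked-letter i = marked⇒letter i _ (FP.toℕ<n (lookup w i))
                                      (subst₂ _<_ (V≡rows (inject₁ i)) (V≡rows (F.suc i)) (proj₁ (V-marks i)))
        where
        V≡rows : ∀ a → entry (V a) (toℕ (lookup w i)) ≡ entry (rows a) (toℕ (lookup w i))
        V≡rows a = cong (λ v → entry v (toℕ (lookup w i))) (sortedEnumeration-unique V-sortedEnumeration a)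

-- Alcoves with the same word

module _ {d r : ℕ} (d≥1 : 1 ≤ d) {p p′ : QPoint d} (gen : GenericInterior r d p) (gen′ : GenericInterior r d p′) where
  private
    module A = Alcove d r d≥1 p gen
    module B = Alcove d r d≥1 p′ gen′

  word≡⇒vertex≡ : A.word ≡ B.word → ∀ i → A.vertex i ≡ B.vertex i
  word≡⇒vertex≡ word≡ i = psumℕ-injective _ _ λ j j≤1+d →
    trans (A.psum-vertex i j j≤1+d) (trans (vertexPsum≡ j j≤1+d) (sym (B.psum-vertex i j j≤1+d)))
    where
    B-letter≡A-letter : ∀ i → i < d → B.letter i ≡ A.letter i
    B-letter≡A-letter i i<d = trans (B.letter≡toℕ-word i i<d)
      (trans (cong (λ w → toℕ (lookup w (fromℕ< i<d))) (sym word≡)) (sym (A.letter≡toℕ-word i i<d)))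
    same-floors-and-ranks : ∀ t → t < d → A.rank t ≡ B.rank t × A.fN (suc t) ≡ B.fN (suc t)
    same-floors-and-ranks = LexOrder.lex-unique d A.letter A.inverse B.inverse (λ _ _ → refl) B-letter≡A-letter A.lex B.lex
    vertexPsum≡ : ∀ j → j ≤ suc d → A.vertexPsum i j ≡ B.vertexPsum i j
    vertexPsum≡ zero    _     = trans (A.vertexPsum-0 i) (sym (B.vertexPsum-0 i))
    vertexPsum≡ (suc t) t<1+d = Sum.[ inner , top ] (m≤n⇒m<n∨m≡n (≤-pred t<1+d))
      where
      inner : t < d → A.vertexPsum i (suc t) ≡ B.vertexPsum i (suc t)
      inner t<d = trans (A.vertexPsum-inner i t t<d)
        (trans (cong₂ (λ m k → m + 𝟙[ i ≤ k ]) (proj₂ (same-floors-and-ranks t t<d)) (proj₁ (same-floors-and-ranks t t<d)))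
               (sym (B.vertexPsum-inner i t t<d)))
      top : t ≡ d → A.vertexPsum i (suc t) ≡ B.vertexPsum i (suc t)
      top t≡d = subst (λ s → A.vertexPsum i (suc s) ≡ B.vertexPsum i (suc s)) (sym t≡d)
                      (trans (A.vertexPsum-top i) (sym (B.vertexPsum-top i)))

-- Realising a word

module Realisation {d r : ℕ} (d≥1 : 1 ≤ d) (r≥1 : 1 ≤ r) (w : Vec (Fin r) d) where

  W : ℕ → ℕ
  W i with i <? d
  ... | yes i<d = toℕ (lookup w (fromℕ< i<d))
  ... | no  _   = 0

  W<r : ∀ i → W i < r
  W<r i with i <? d
  ... | yes i<d = FP.toℕ<n (lookup w (fromℕ< i<d))
  ... | no  _   = r≥1

  W-toℕ : ∀ (i : Fin d) → W (toℕ i) ≡ toℕ (lookup w i)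
  W-toℕ i with toℕ i <? d
  ... | yes i<d = cong (toℕ ∘ lookup w) (FP.fromℕ<-toℕ i i<d)
  ... | no  i≮d = ⊥-elim (i≮d (FP.toℕ<n i))

  -- ε = 1 / (d + 1), since mkℚ n k denotes n / (k + 1).
  ε : ℚ
  ε = mkℚ (+ 1) d (1-coprimeTo (suc d))

  slot : ℕ → ℚ
  slot c = ι (+ c) ℚ.* ε

  slot-mono : ∀ c c′ → c < c′ → slot c ℚ.< slot c′
  slot-mono _ _ c<c′ = ℚP.*-monoˡ-<-pos ε (ι-mono-< (+<+ c<c′))

  slot-cancel : ∀ c c′ → slot c ℚ.< slot c′ → c < c′
  slot-cancel _ _ sc<sc′ = ℤP.drop‿+<+ (ι-cancel-< (ℚP.*-cancelʳ-<-nonNeg ε sc<sc′))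

  slot-injective : ∀ c c′ → slot c ≡ slot c′ → c ≡ c′
  slot-injective c c′ sc≡sc′ with <-cmp c c′
  ... | tri< c<c′ _ _ = ⊥-elim (ℚP.<-irrefl sc≡sc′ (slot-mono c c′ c<c′))
  ... | tri≈ _ c≡c′ _ = c≡c′
  ... | tri> _ _ c′<c = ⊥-elim (ℚP.<-irrefl (sym sc≡sc′) (slot-mono c′ c c′<c))

  slot-0 : slot 0 ≡ 0ℚ
  slot-0 = ℚP.*-zeroˡ ε

  slot-pos : ∀ c → 0ℚ ℚ.< slot (suc c)
  slot-pos c = subst (ℚ._< slot (suc c)) slot-0 (slot-mono 0 (suc c) (s≤s z≤n))

  slot-unit : ∀ c → c ≤ d → InUnit (slot c)
  slot-unit zero    _     = ℚP.≤-reflexive (sym slot-0) , subst (ℚ._< 1ℚ) (sym slot-0) 0ℚ<1ℚ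
  slot-unit (suc c) c<1+d =
    ℚP.<⇒≤ (slot-pos c) , subst (slot (suc c) ℚ.<_) slot-[1+d] (slot-mono (suc c) (suc d) (s≤s c<1+d))
    where
    slot-[1+d] : slot (suc d) ≡ 1ℚ
    slot-[1+d] = trans (cong (ℚ._* ε) (ι≡mkℚ (+ suc d))) (ℚP.*-inverseʳ (mkℚ (+ suc d) 0 (coprime-sym (1-coprimeTo (suc d)))))

  u : ℕ → ℚ
  u i = ι (+ W i) ℚ.+ slot (suc i)

  floor-u : ∀ i → i < d → floor (u i) ≡ + W i
  floor-u i i<d = floor-ι+ (+ W i) (slot-unit (suc i) i<d)

  u-frac : ∀ i → u i ℚ.- ι (+ W i) ≡ slot (suc i)
  u-frac i = solve 2 (λ a b → (a :+ b) :- a := b) refl (ι (+ W i)) (slot (suc i))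
    where open +-*-Solver

  u-injective : ∀ a b → a < d → b < d → a ≢ b → u a ≢ u b
  u-injective a b a<d b<d a≢b ua≡ub = a≢b (suc-injective (slot-injective (suc a) (suc b) (begin
    slot (suc a)          ≡⟨ u-frac a ⟨
    u a ℚ.- ι (+ W a)     ≡⟨ cong₂ (λ v m → v ℚ.- ι (+ m)) ua≡ub Wa≡Wb ⟩
    u b ℚ.- ι (+ W b)     ≡⟨ u-frac b ⟩
    slot (suc b)          ∎)))
    where
    open ≡-Reasoning
    Wa≡Wb : W a ≡ W b
    Wa≡Wb = ℤP.+-injective (trans (sym (floor-u a a<d)) (trans (cong floor ua≡ub) (floor-u b b<d)))

  u-pos : ∀ i → 0ℚ ℚ.< u i
  u-pos i = subst (ℚ._< u i) (ℚP.+-identityʳ 0ℚ) (ℚP.+-mono-≤-< (ι-mono-≤ {0ℤ} {+ W i} (+≤+ z≤n)) (slot-pos i))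

  u<r : ∀ i → i < d → u i ℚ.< ι (+ r)
  u<r i i<d = ℚP.<-≤-trans (subst (u i ℚ.<_) (sym (ι-+ (+ W i) 1ℤ)) (ℚP.+-monoʳ-< (ι (+ W i)) (proj₂ (slot-unit (suc i) i<d))))
                           (ι-mono-≤ (subst (ℤ._≤ + r) (ℤP.pos-+ (W i) 1) (+≤+ (subst (_≤ r) (+-comm 1 (W i)) (W<r i)))))

  open Ranking d u u-injective

  atPosition : {A : Set} → (ℕ → A) → A → ∀ t → Dec (t < d) → A
  atPosition inner last t (yes _) = inner t
  atPosition inner last t (no  _) = last

  atPosition-inner : ∀ {A : Set} (inner : ℕ → A) last t dec → t < d → atPosition inner last t dec ≡ inner t
  atPosition-inner inner last t (yes _)   _   = refl
  atPosition-inner inner last t (no  t≮d) t<d = ⊥-elim (t≮d t<d)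

  atPosition-last : ∀ {A : Set} (inner : ℕ → A) last dec → atPosition inner last d dec ≡ last
  atPosition-last inner last (yes d<d) = ⊥-elim (<-irrefl refl d<d)
  atPosition-last inner last (no  _)   = refl

  G : ℕ → ℤ
  G zero    = 0ℤ
  G (suc t) = atPosition (λ t → + W (unrank t)) (+ r) t (t <? d)

  C : ℕ → ℕ
  C zero    = 0
  C (suc t) = atPosition (suc ∘ unrank) 0 t (t <? d)

  Y : ℕ → ℚ
  Y j = ι (G j) ℚ.+ slot (C j)

  G-inner : ∀ t → t < d → G (suc t) ≡ + W (unrank t)
  G-inner t = atPosition-inner _ (+ r) t (t <? d)

  C-inner : ∀ t → t < d → C (suc t) ≡ suc (unrank t)
  C-inner t = atPosition-inner (suc ∘ unrank) 0 t (t <? d)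

  G-top : G (suc d) ≡ + r
  G-top = atPosition-last _ (+ r) (d <? d)

  C-top : C (suc d) ≡ 0
  C-top = atPosition-last (suc ∘ unrank) 0 (d <? d)

  C≤d : ∀ j → C j ≤ d
  C≤d zero    = z≤n
  C≤d (suc t) = bounded (t <? d)
    where
    bounded : ∀ dec → atPosition (suc ∘ unrank) 0 t dec ≤ d
    bounded (yes t<d) = InverseOn.h-< inverse t t<d
    bounded (no  _)   = z≤n

  C-distinct : ∀ a b → Pair d a b → C a ≢ C b
  C-distinct zero    (suc t) (_ , 1+t≤1+d , not-0-top) Ca≡Cb = Sum.[ inner , last ] (m≤n⇒m<n∨m≡n (≤-pred 1+t≤1+d))
    where
    inner : t < d → ⊥
    inner t<d = 0≢1+n (trans Ca≡Cb (C-inner t t<d))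
    last : t ≡ d → ⊥
    last t≡d = not-0-top (refl , cong suc t≡d)
  C-distinct (suc s) (suc t) (1+s<1+t , 1+t≤1+d , _) Ca≡Cb = Sum.[ inner , last ] (m≤n⇒m<n∨m≡n (≤-pred 1+t≤1+d))
    where
    s<t = ≤-pred 1+s<1+t
    inner : t < d → ⊥
    inner t<d = <-irrefl (unrank-injective (suc-injective (trans (sym (C-inner s s<d)) (trans Ca≡Cb (C-inner t t<d))))) s<t
      where
      open InverseOn inverse
      s<d = <-trans s<t t<d
      unrank-injective : unrank s ≡ unrank t → s ≡ t
      unrank-injective eq = trans (sym (g∘h s s<d)) (trans (cong rank eq) (g∘h t t<d))
    last : t ≡ d → ⊥
    last t≡d = 0≢1+n (sym (trans (sym (C-inner s (<-≤-trans s<t (≤-reflexive t≡d))))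
                                 (trans Ca≡Cb (trans (cong (C ∘ suc) t≡d) C-top))))

  Y-0 : Y 0 ≡ 0ℚ
  Y-0 = trans (ℚP.+-identityˡ (slot 0)) slot-0

  Y-inner : ∀ t → t < d → Y (suc t) ≡ u (unrank t)
  Y-inner t t<d = cong₂ (λ m c → ι m ℚ.+ slot c) (G-inner t t<d) (C-inner t t<d)

  Y-top : Y (suc d) ≡ ι (+ r)
  Y-top = trans (cong₂ (λ m c → ι m ℚ.+ slot c) G-top C-top) (trans (cong (ι (+ r) ℚ.+_) slot-0) (ℚP.+-identityʳ (ι (+ r))))

  Y-increasing : ∀ k → k ≤ d → Y k ℚ.< Y (suc k)
  Y-increasing zero    _       = subst₂ ℚ._<_ (sym Y-0) (sym (Y-inner 0 d≥1)) (u-pos (unrank 0))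
  Y-increasing (suc t) 1+t≤d = subst (ℚ._< Y (suc (suc t))) (sym (Y-inner t 1+t≤d)) next
    where
    next : u (unrank t) ℚ.< Y (suc (suc t))
    next = Sum.[ inner , last ] (m≤n⇒m<n∨m≡n 1+t≤d)
      where
      inner : suc t < d → u (unrank t) ℚ.< Y (suc (suc t))
      inner 1+t<d = subst (u (unrank t) ℚ.<_) (sym (Y-inner (suc t) 1+t<d))
                          (ranks⇒lists inverse keyOrder-strictTotal rank-ranks t (suc t) 1+t<d (n<1+n t))
      last : suc t ≡ d → u (unrank t) ℚ.< Y (suc (suc t))
      last 1+t≡d = subst (u (unrank t) ℚ.<_) (sym (trans (cong (Y ∘ suc) 1+t≡d) Y-top)) (u<r (unrank t) (InverseOn.h-< inverse t 1+t≤d))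

  point : QPoint d
  point = fromPsumsℚ (suc d) Y

  psum-point : ∀ j → j ≤ suc d → psumℚ point j ≡ Y j
  psum-point = psumℚ-fromPsumsℚ (suc d) Y Y-0

  point-generic : GenericInterior r d point
  point-generic = trans (psum-point (suc d) ≤-refl) Y-top , positive , nonInteger
    where
    positive : ∀ (k : Fin (suc d)) → 0ℚ ℚ.< lookup point k
    positive k = subst (0ℚ ℚ.<_) (sym (VP.lookup∘tabulate (λ t → Y (suc (toℕ t)) ℚ.- Y (toℕ t)) k))
                       (p<q⇒0<q-p (Y-increasing (toℕ k) (≤-pred (FP.toℕ<n k))))
    nonInteger : ∀ a b → Pair d a b → ¬ IsInteger (Lℚ point a b)
    nonInteger a b ab@(a<b , b≤1+d , _) (m , L≡m) =
      unit-diff-not-integer (slot-unit (C a) (C≤d a)) (slot-unit (C b) (C≤d b)) (G a) (G b) m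
        (C-distinct a b ab ∘ slot-injective (C a) (C b))
        (trans (sym (cong₂ ℚ._-_ (psum-point b b≤1+d) (psum-point a (<⇒≤ (<-≤-trans a<b b≤1+d))))) L≡m)

  private
    module A = Alcove d r d≥1 point point-generic

  A-fN : ∀ t → t < d → A.fN (suc t) ≡ W (unrank t)
  A-fN t t<d = ℤP.+-injective (begin
    + A.fN (suc t)                   ≡⟨ A.+fN≡floor (suc t) ⟩
    floor (psumℚ point (suc t))      ≡⟨ cong floor (trans (psum-point (suc t) (s≤s (<⇒≤ t<d))) (Y-inner t t<d)) ⟩
    floor (u (unrank t))             ≡⟨ floor-u (unrank t) (InverseOn.h-< inverse t t<d) ⟩
    + W (unrank t)                   ∎)
    where open ≡-Reasoning

  A-key : ∀ t → t < d → A.key t ≡ slot (suc (unrank t))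
  A-key t t<d = begin
    A.φ (suc t)                                               ≡⟨ A.φ-unfold (suc t) ⟩
    psumℚ point (suc t) ℚ.- ι (floor (psumℚ point (suc t)))
      ≡⟨ cong (λ q → q ℚ.- ι (floor q)) (trans (psum-point (suc t) (s≤s (<⇒≤ t<d))) (Y-inner t t<d)) ⟩
    u (unrank t) ℚ.- ι (floor (u (unrank t)))
      ≡⟨ cong (λ m → u (unrank t) ℚ.- ι m) (floor-u (unrank t) (InverseOn.h-< inverse t t<d)) ⟩
    u (unrank t) ℚ.- ι (+ W (unrank t))                       ≡⟨ u-frac (unrank t) ⟩
    slot (suc (unrank t))                                     ∎
    where open ≡-Reasoning

  A-rank : ∀ t → t < d → A.rank t ≡ unrank t
  A-rank = ranking-unique A.rank-< (InverseOn-sym inverse) A.keyOrder-strictTotal A.rank-ranks unrank-ranks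
    where
    unrank-ranks : Ranks d A.KeyOrder unrank
    unrank-ranks a b a<d b<d ka<kb = ≤-pred (slot-cancel (suc (unrank a)) (suc (unrank b)) (subst₂ ℚ._<_ (A-key a a<d) (A-key b b<d) ka<kb))

  A-letter : ∀ i → i < d → A.letter i ≡ W i
  A-letter i i<d = begin
    A.fN (suc (A.unrank i))              ≡⟨ cong (A.fN ∘ suc ∘ A.unrank) (trans (A-rank (rank i) (rank-< i i<d)) (h∘g i i<d)) ⟨
    A.fN (suc (A.unrank (A.rank (rank i)))) ≡⟨ cong (A.fN ∘ suc) (InverseOn.h∘g A.inverse (rank i) (rank-< i i<d)) ⟩
    A.fN (suc (rank i))                  ≡⟨ A-fN (rank i) (rank-< i i<d) ⟩
    W (unrank (rank i))                  ≡⟨ cong W (h∘g i i<d) ⟩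
    W i                                  ∎
    where
    open ≡-Reasoning
    open InverseOn inverse using (h∘g)

  A-word : A.word ≡ w
  A-word = lookup-ext λ i → FP.toℕ-injective (trans (A.toℕ-word i) (trans (A-letter (toℕ i) (FP.toℕ<n i)) (W-toℕ i)))

  realisation-isWord : IsWord₁ r d (InClosedCell r d point) w
  realisation-isWord =
    subst (IsWord₁ r d (InClosedCell r d point)) A-word (A.Enumeration.isWord (InClosedCell r d point) (λ _ → mk⇔ id id))

-- The bijection word₁

word₁-wellDefined : ∀ {d r} → 1 ≤ d → (S : Point d → Set) → IsAlcove r d S →
                    Σ (Vec (Fin r) d) λ w → IsWord₁ r d S w × ((w′ : Vec (Fin r) d) → IsWord₁ r d S w′ → w′ ≡ w)
word₁-wellDefined d≥1 S (p , gen , S⇔cell) = Alcove.word _ _ d≥1 p gen , isWord , word-unique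
  where open Alcove.Enumeration _ _ d≥1 p gen S S⇔cell

word₁-injective : ∀ {d r} → 1 ≤ d → (S S′ : Point d → Set) (w : Vec (Fin r) d) → IsAlcove r d S → IsAlcove r d S′ →
                  IsWord₁ r d S w → IsWord₁ r d S′ w → (x : Point d) → S x ⇔ S′ x
word₁-injective {d} {r} d≥1 S S′ w (p , gen , S⇔cell) (p′ , gen′ , S′⇔cell) S-w S′-w x =
  mk⇔ (Equivalence.from (B.rows-enumerate x) ∘ map₂ (trans (sym (rows≡ _))) ∘ Equivalence.to (A.rows-enumerate x))
      (Equivalence.from (A.rows-enumerate x) ∘ map₂ (trans (rows≡ _)) ∘ Equivalence.to (B.rows-enumerate x))
  where
  module A = Alcove.Enumeration d r d≥1 p gen S S⇔cell
  module B = Alcove.Enumeration d r d≥1 p′ gen′ S′ S′⇔cell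
  rows≡ : ∀ i → Alcove.rows d r d≥1 p gen i ≡ Alcove.rows d r d≥1 p′ gen′ i
  rows≡ i = word≡⇒vertex≡ d≥1 gen gen′ (trans (sym (A.word-unique w S-w)) (B.word-unique w S′-w)) (toℕ i)

word₁-surjective : ∀ {d r} → 1 ≤ d → 1 ≤ r → (w : Vec (Fin r) d) → Σ (Point d → Set) λ S → IsAlcove r d S × IsWord₁ r d S w
word₁-surjective {d} {r} d≥1 r≥1 w =
  InClosedCell r d point , (point , point-generic , λ _ → mk⇔ id id) , realisation-isWord
  where open Realisation d≥1 r≥1 w

theorem3p8 : (d r : ℕ) → 1 ≤ d → 1 ≤ r →
    ((S : Point d → Set) → IsAlcove r d S →
      Σ (Vec (Fin r) d) λ w → IsWord₁ r d S w × ((w′ : Vec (Fin r) d) → IsWord₁ r d S w′ → w′ ≡ w))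
    × ((S S′ : Point d → Set) (w : Vec (Fin r) d) → IsAlcove r d S → IsAlcove r d S′ →
        IsWord₁ r d S w → IsWord₁ r d S′ w → (x : Point d) → S x ⇔ S′ x)
    × ((w : Vec (Fin r) d) → Σ (Point d → Set) λ S → IsAlcove r d S × IsWord₁ r d S w)
theorem3p8 d r d≥1 r≥1 = word₁-wellDefined d≥1 , word₁-injective d≥1 , word₁-surjective d≥1 r≥1
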